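{- Let $t$ be the Thue–Morse sequence and let $f(n)$ be the number of distinct unbordered words of length $n$ that are factors of $t$. Then \begin{align*} f(8n)&=2f(4n)&(n\ge1),\\ f(8n+1)&=f(4n+1)&(n\ge0),\\ f(8n+2)&=f(4n+1)+f(4n+3)&(n\ge1),\\ f(8n+3)&=-f(4n+1)+f(4n+2)&(n\ge2),\\ f(8n+4)&=2f(4n+2)&(n\ge1),\\ f(8n+5)&=f(4n+3)&(n\ge0),\\ f(8n+6)&=-f(4n+1)+f(4n+2)+f(4n+3)&(n\ge2),\\ f(8n+7)&=2f(4n+1)+f(4n+3)&(n\ge3). \end{align*} In particular, $f(8n+s)=\sum_{k=0}^{3}c_{s,k}f(4n+k)$ holds for all $n\ge3$ and $0\le s<8$ with suitable constants $c_{s,k}$, i.e. $f$ is $2$-recursive with offset $3$, exponents $3$ and $2$ and index shift bounds $0$ and $3$.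
   Context: The Thue–Morse sequence $t\colon\mathbb{N}_0\to\{0,1\}$ is given by $t(n)=$ (number of ones in the binary expansion of $n$) mod $2$. A factor of $t$ is a word $t(i)t(i+1)\cdots t(j)$ for some $0\le i\le j$, and the empty word is also counted as a factor. A word $w$ is bordered if some non-empty word $v\neq w$ is both a prefix and a suffix of $w$; otherwise $w$ is unbordered (so the empty word and all words of length $1$ are unbordered). -}

module Defs where

open import Data.Bool using (Bool; true; false; _xor_)
open import Data.Nat using (ℕ; zero; suc; _+_; _*_; _≤_)
open import Data.Nat.DivMod using (_/_; _%_)
open import Data.Nat.Properties using (_≟_)
open import Relation.Nullary.Decidable using (⌊_⌋)
open import Data.List using (List; []; _∷_; _++_; map; length)
open import Data.List.Membership.Propositional using (_∈_)
open import Data.List.Relation.Unary.Unique.Propositional using (Unique)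
open import Data.Product using (Σ; ∃; _×_)
open import Relation.Binary.PropositionalEquality using (_≡_; _≢_)
open import Relation.Nullary using (¬_)
open import Function.Bundles using (_⇔_)

-- Parity of the number of ones in the binary expansion of m, computed with
-- fuel k (k ≥ number of binary digits of m suffices; k = m always works).
onesParity : ℕ → ℕ → Bool
onesParity zero    m = false
onesParity (suc k) m = ⌊ m % 2 ≟ 1 ⌋ xor onesParity k (m / 2)

-- Thue–Morse sequence, with the letter 1 encoded as true and 0 as false.
t : ℕ → Bool
t n = onesParity n n

window : ℕ → ℕ → List Bool
window i zero      = []
window i (suc len) = t i ∷ window (suc i) len

Factor : List Bool → Set
Factor w = ∃ λ i → w ≡ window i (length w)

Prefix : List Bool → List Bool → Set
Prefix v w = ∃ λ u → v ++ u ≡ w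

Suffix : List Bool → List Bool → Set
Suffix v w = ∃ λ u → u ++ v ≡ w

Bordered : List Bool → Set
Bordered w = ∃ λ v → v ≢ [] × v ≢ w × Prefix v w × Suffix v w

Unbordered : List Bool → Set
Unbordered w = ¬ Bordered w

UnbFactor : ℕ → List Bool → Set
UnbFactor n w = length w ≡ n × Factor w × Unbordered w

IsCount : ℕ → ℕ → Set
IsCount n k = ∃ λ (L : List (List Bool)) →
  Unique L × (∀ w → (w ∈ L) ⇔ UnbFactor n w) × length L ≡ k

-- A factor of t of length m ≥ 4 is the image μ u of a factor u of about half the length,
-- possibly with its first and/or last letter removed, and by synchronisation (occurrences of a
-- factor of length 4 lie an even distance apart) no factor arises in two ways. Whether such an image
-- is bordered, together with its first and last two letters and its borders of length 1, 2 and 3, is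
-- determined by the same finite profile of u: a border of length at least 4 of the image has an even
-- shift, hence comes from a border of u. So any weighted count Σ h (profile w) over the factors of
-- length 2n or 2n + 1 is a weighted count over lengths n and n + 1. Three such steps write
-- f (8n + s) − Σ_j c_{s,j} f (4n + j) as weighted counts over lengths n, …, n + 4 whose weights vanish
-- identically after two more steps; this proves the recurrences for n ≥ 8, and 3 ≤ n < 8 is computed.

module Submission where

open import Defs
open import Data.Bool using (Bool; true; false; not; _xor_; _∧_; _∨_; if_then_else_; T)
import Data.Bool.Properties as Bool
open import Data.Bool.Properties using (not-¬; not-involutive; not-injective; ∨-zeroʳ; ∨-identityʳ; ∨-assoc)
open import Data.Empty using (⊥; ⊥-elim)
open import Data.Fin using (Fin; toℕ; #_)
import Data.Fin as Fin
open import Data.Fin.Properties using (all?)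
open import Data.Integer using (ℤ; +_)
import Data.Integer as ℤ
import Data.Integer.Properties as ℤP
open import Data.Integer.Tactic.RingSolver renaming (solve-∀ to solve-∀-ℤ)
open import Data.List using (List; []; _∷_; _++_; length; map; take; drop; filter; foldr)
open import Data.List.Properties
  using (∷-injective; length-++; ++-identityʳ; take++drop≡id; length-take; length-drop; map-∘)
open import Data.List.Membership.Propositional using (_∈_)
open import Data.List.Membership.Propositional.Properties
  using (∈-map⁺; ∈-map⁻; ∈-++⁺ˡ; ∈-++⁺ʳ; ∈-++⁻; ∈-filter⁻; ∈-filter⁺)
open import Data.List.Relation.Unary.All using ([]; _∷_)
open import Data.List.Relation.Unary.AllPairs using ([]; _∷_)
open import Data.List.Relation.Unary.Any using (here; there)
open import Data.List.Relation.Unary.Unique.Propositional using (Unique)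
import Data.List.Relation.Unary.Unique.Propositional.Properties as UP
open import Data.Nat
open import Data.Nat.DivMod
open import Data.Nat.Properties
open import Data.Nat.Tactic.RingSolver using (solve-∀)
open import Data.Product using (Σ; ∃; _×_; _,_; proj₁; proj₂)
open import Data.Sum using (_⊎_; inj₁; inj₂)
open import Data.Vec using (Vec; []; _∷_; lookup)
open import Function using (_$_; _∘_)
open import Function.Bundles using (mk⇔)
open import Function.Definitions using (Injective)
open import Relation.Binary.PropositionalEquality
open import Relation.Nullary using (¬_; Dec; yes; no)
open import Relation.Nullary.Decidable using (⌊_⌋; toWitness)

onesParity-0 : ∀ k → onesParity k 0 ≡ false
onesParity-0 zero    = refl
onesParity-0 (suc k) = onesParity-0 k

m≤1+n⇒m/2≤n : ∀ m n → m ≤ suc n → m / 2 ≤ n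
m≤1+n⇒m/2≤n zero    n _  = z≤n
m≤1+n⇒m/2≤n (suc m) n le = ≤-pred (≤-trans (m/n<m (suc m) 2 (s≤s (s≤s z≤n))) le)

onesParity-fuel : ∀ k j m → m ≤ k → m ≤ j → onesParity k m ≡ onesParity j m
onesParity-fuel zero    j       .zero z≤n _   = sym (onesParity-0 j)
onesParity-fuel (suc k) zero    .zero _   z≤n = onesParity-0 (suc k)
onesParity-fuel (suc k) (suc j) m     m≤k m≤j =
  cong (⌊ m % 2 ≟ 1 ⌋ xor_)
       (onesParity-fuel k j (m / 2) (m≤1+n⇒m/2≤n m k m≤k) (m≤1+n⇒m/2≤n m j m≤j))

[2*n]%2≡0 : ∀ n → (2 * n) % 2 ≡ 0
[2*n]%2≡0 n = trans (cong (_% 2) (*-comm 2 n)) (m*n%n≡0 n 2)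

[2*n]/2≡n : ∀ n → (2 * n) / 2 ≡ n
[2*n]/2≡n n = trans (cong (_/ 2) (*-comm 2 n)) (m*n/n≡m n 2)

[1+2*n]%2≡1 : ∀ n → suc (2 * n) % 2 ≡ 1
[1+2*n]%2≡1 n = trans (cong (λ m → suc m % 2) (*-comm 2 n)) ([m+kn]%n≡m%n 1 n 2)

[1+2*n]/2≡n : ∀ n → suc (2 * n) / 2 ≡ n
[1+2*n]/2≡n n = trans (cong (λ m → suc m / 2) (*-comm 2 n))
  (trans (+-distrib-/ 1 (n * 2) (subst (λ r → 1 + r < 2) (sym (m*n%n≡0 n 2)) ≤-refl))
         (m*n/n≡m n 2))

t[2n]≡t[n] : ∀ n → t (2 * n) ≡ t n
t[2n]≡t[n] zero    = refl
t[2n]≡t[n] (suc n) = begin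
  onesParity (2 * suc n) (2 * suc n)
    ≡⟨ cong (λ k → onesParity k (2 * suc n)) (*-suc 2 n) ⟩
  ⌊ (2 * suc n) % 2 ≟ 1 ⌋ xor onesParity (suc (2 * n)) ((2 * suc n) / 2)
    ≡⟨ cong₂ (λ r q → ⌊ r ≟ 1 ⌋ xor onesParity (suc (2 * n)) q) ([2*n]%2≡0 (suc n)) ([2*n]/2≡n (suc n)) ⟩
  onesParity (suc (2 * n)) (suc n)
    ≡⟨ onesParity-fuel (suc (2 * n)) (suc n) (suc n) (s≤s (m≤n*m n 2)) ≤-refl ⟩
  t (suc n) ∎
  where open ≡-Reasoning

t[1+2n]≡not-t[n] : ∀ n → t (suc (2 * n)) ≡ not (t n)
t[1+2n]≡not-t[n] n = begin
  ⌊ suc (2 * n) % 2 ≟ 1 ⌋ xor onesParity (2 * n) (suc (2 * n) / 2)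
    ≡⟨ cong₂ (λ r q → ⌊ r ≟ 1 ⌋ xor onesParity (2 * n) q) ([1+2*n]%2≡1 n) ([1+2*n]/2≡n n) ⟩
  not (onesParity (2 * n) n)
    ≡⟨ cong not (onesParity-fuel (2 * n) n n (m≤n*m n 2) ≤-refl) ⟩
  not (t n) ∎
  where open ≡-Reasoning

t-even : ∀ {m} n → m ≡ 2 * n → t m ≡ t n
t-even n refl = t[2n]≡t[n] n

t-odd : ∀ {m} n → m ≡ suc (2 * n) → t m ≡ not (t n)
t-odd n refl = t[1+2n]≡not-t[n] n

even⊎odd : ∀ m → (∃ λ n → m ≡ 2 * n) ⊎ (∃ λ n → m ≡ suc (2 * n))
even⊎odd zero = inj₁ (0 , refl)
even⊎odd (suc m) with even⊎odd m
... | inj₁ (n , refl) = inj₂ (n , refl)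
... | inj₂ (n , refl) = inj₁ (suc n , sym (*-suc 2 n))

-- Synchronisation

t-cube-free : ∀ m → t m ≡ t (1 + m) → t (1 + m) ≡ t (2 + m) → ⊥
t-cube-free m e₁ e₂ with even⊎odd m
... | inj₁ (n , refl) =
  not-¬ refl (trans (sym (t[2n]≡t[n] n)) (trans e₁ (t[1+2n]≡not-t[n] n)))
... | inj₂ (n , refl) =
  not-¬ refl (trans (sym (t-even (suc n) 2+2n≡2[1+n])) (trans e₂ (t-odd (suc n) (cong suc 2+2n≡2[1+n]))))
  where
  2+2n≡2[1+n] : suc (suc (2 * n)) ≡ 2 * suc n
  2+2n≡2[1+n] = sym (*-suc 2 n)

not-flip : ∀ {a b} → a ≡ not b → not a ≡ b
not-flip {b = b} e = trans (cong not e) (not-involutive b)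

-- Agreement would give t y = ¬ t x = t (1 + y) and t (1 + y) = ¬ t (1 + x) = t (2 + y).
even-odd-mismatch : ∀ x y → ¬ (∀ i → i < 4 → t (2 * x + i) ≡ t (suc (2 * y) + i))
even-odd-mismatch x y agree =
  t-cube-free y (trans (sym (not-flip e₀)) e₁) (trans (sym (not-flip e₂)) e₃)
  where
  e₀ : t x ≡ not (t y)
  e₀ = trans (sym (t-even x (+-identityʳ (2 * x))))
             (trans (agree 0 (s≤s z≤n)) (t-odd y (+-identityʳ (suc (2 * y)))))
  e₁ : not (t x) ≡ t (suc y)
  e₁ = trans (sym (t-odd x (+-comm (2 * x) 1)))
             (trans (agree 1 (s≤s (s≤s z≤n))) (t-even (suc y) (ix₁ y)))
    where ix₁ : ∀ y → suc (2 * y) + 1 ≡ 2 * suc y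
          ix₁ = solve-∀
  e₂ : t (suc x) ≡ not (t (suc y))
  e₂ = trans (sym (t-even (suc x) (ix₂ x))) (trans (agree 2 (s≤s (s≤s (s≤s z≤n)))) (t-odd (suc y) (ix₃ y)))
    where ix₂ : ∀ x → 2 * x + 2 ≡ 2 * suc x
          ix₂ = solve-∀
          ix₃ : ∀ y → suc (2 * y) + 2 ≡ suc (2 * suc y)
          ix₃ = solve-∀
  e₃ : not (t (suc x)) ≡ t (2 + y)
  e₃ = trans (sym (t-odd (suc x) (ix₃ x))) (trans (agree 3 ≤-refl) (t-even (2 + y) (ix₄ y)))
    where ix₃ : ∀ x → 2 * x + 3 ≡ suc (2 * suc x)
          ix₃ = solve-∀
          ix₄ : ∀ y → suc (2 * y) + 3 ≡ 2 * (2 + y)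
          ix₄ = solve-∀

record Agree (p d L : ℕ) : Set where
  constructor agreement
  field at : ∀ i → i < L → t (p + i) ≡ t (p + i + d)

distance-even : ∀ p d → Agree p d 4 → ∃ λ e → d ≡ 2 * e
distance-even p d (agreement agree) with even⊎odd d
... | inj₁ d-even = d-even
... | inj₂ (e , refl) with even⊎odd p
...   | inj₁ (x , refl) =
  ⊥-elim (even-odd-mismatch x (x + e) λ i i<4 → trans (agree i i<4) (cong t (ix x e i)))
  where ix : ∀ x e i → 2 * x + i + suc (2 * e) ≡ suc (2 * (x + e)) + i
        ix = solve-∀
...   | inj₂ (x , refl) =
  ⊥-elim (even-odd-mismatch (suc (x + e)) x λ i i<4 → sym (trans (agree i i<4) (cong t (ix x e i))))
  where ix : ∀ x e i → suc (2 * x) + i + suc (2 * e) ≡ 2 * suc (x + e) + i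
        ix = solve-∀

agree-at : ∀ {p d L} → Agree p d L → ∀ {j} i → i < L → p + i ≡ j → t j ≡ t (j + d)
agree-at (agreement agree) i i<L refl = agree i i<L

agree-child : ∀ {j} y e → j ≡ 2 * y ⊎ j ≡ suc (2 * y) → t y ≡ t (y + e) → t j ≡ t (j + 2 * e)
agree-child y e (inj₁ refl) eq =
  trans (t[2n]≡t[n] y) (trans eq (sym (t-even (y + e) (sym (*-distribˡ-+ 2 y e)))))
agree-child y e (inj₂ refl) eq =
  trans (t[1+2n]≡not-t[n] y) (trans (cong not eq) (sym (t-odd (y + e) (cong suc (sym (*-distribˡ-+ 2 y e))))))

agree-parent : ∀ {j} y e → j ≡ 2 * y ⊎ j ≡ suc (2 * y) → t j ≡ t (j + 2 * e) → t y ≡ t (y + e)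
agree-parent y e (inj₁ refl) eq =
  trans (sym (t[2n]≡t[n] y)) (trans eq (t-even (y + e) (sym (*-distribˡ-+ 2 y e))))
agree-parent y e (inj₂ refl) eq = not-injective
  (trans (sym (t[1+2n]≡not-t[n] y)) (trans eq (t-odd (y + e) (cong suc (sym (*-distribˡ-+ 2 y e))))))

agree-shrink : ∀ {p d L} a L′ → Agree p d L → a + L′ ≤ L → Agree (p + a) d L′
agree-shrink {p} a L′ agree a+L′≤L = agreement λ i i<L′ →
  agree-at agree (a + i) (≤-trans (+-monoʳ-< a i<L′) a+L′≤L) (sym (+-assoc p a i))

agree-double : ∀ q e K → Agree q e K → Agree (2 * q) (2 * e) (2 * K)
agree-double q e K (agreement agree) = agreement λ i i<2K → double i i<2K
  where
  double : ∀ i → i < 2 * K → t (2 * q + i) ≡ t (2 * q + i + 2 * e)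
  double i i<2K with even⊎odd i
  ... | inj₁ (x , refl) =
    agree-child (q + x) e (inj₁ (sym (*-distribˡ-+ 2 q x))) (agree x (*-cancelˡ-< 2 x K i<2K))
  ... | inj₂ (x , refl) =
    agree-child (q + x) e (inj₂ (ix q x)) (agree x (*-cancelˡ-< 2 x K (<-trans (n<1+n _) i<2K)))
    where ix : ∀ q x → 2 * q + suc (2 * x) ≡ suc (2 * (q + x))
          ix = solve-∀

bit : Bool → ℕ
bit false = 0
bit true  = 1

bit≤1 : ∀ a → bit a ≤ 1
bit≤1 false = z≤n
bit≤1 true  = ≤-refl

2+2x≤n : ∀ {x K n} → x < K → 2 * K ≤ n → 2 + 2 * x ≤ n
2+2x≤n {x} x<K 2K≤n = ≤-trans (≤-reflexive (sym (*-suc 2 x))) (≤-trans (*-monoʳ-≤ 2 x<K) 2K≤n)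

-- Each x < K has a child position inside the window of length L at 2q + a.
agree-halve : ∀ q e L K a → 2 * K ≤ L + bit a + 1 → 0 < L →
              Agree (2 * q + bit a) (2 * e) L → Agree q e K
agree-halve q e L K a 2K≤L+a+1 0<L agree = agreement (parent a 2K≤L+a+1 agree)
  where
  parent : ∀ a → 2 * K ≤ L + bit a + 1 → Agree (2 * q + bit a) (2 * e) L →
           ∀ x → x < K → t (q + x) ≡ t (q + x + e)
  parent false 2K≤L+1 agree x x<K =
    agree-parent (q + x) e (inj₁ (ix q x)) (agree-at agree (2 * x) 2x<L refl)
    where ix : ∀ q x → 2 * q + 0 + 2 * x ≡ 2 * (q + x)
          ix = solve-∀
          L+0+1 : ∀ L → L + 0 + 1 ≡ suc L
          L+0+1 = solve-∀
          2x<L : 2 * x < L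
          2x<L = ≤-pred (subst (2 + 2 * x ≤_) (L+0+1 L) (2+2x≤n x<K 2K≤L+1))
  parent true _ agree zero _ =
    agree-parent (q + 0) e (inj₂ (ix q)) (agree-at agree 0 0<L refl)
    where ix : ∀ q → 2 * q + 1 + 0 ≡ suc (2 * (q + 0))
          ix = solve-∀
  parent true 2K≤L+2 agree (suc x) 1+x<K =
    agree-parent (q + suc x) e (inj₁ (ix q x)) (agree-at agree (suc (2 * x)) 1+2x<L refl)
    where ix : ∀ q x → 2 * q + 1 + suc (2 * x) ≡ 2 * (q + suc x)
          ix = solve-∀
          L+1+1 : ∀ L → L + 1 + 1 ≡ suc (suc L)
          L+1+1 = solve-∀
          1+2x<L : suc (2 * x) < L
          1+2x<L = ≤-pred (≤-pred (subst₂ _≤_ (cong (λ n → 2 + n) (*-suc 2 x)) (L+1+1 L) (2+2x≤n 1+x<K 2K≤L+2)))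

-- Factors of t and the Thue–Morse morphism

-- Out-of-range letters read as false.
_!_ : List Bool → ℕ → Bool
[]      ! _     = false
(c ∷ _) ! zero  = c
(_ ∷ w) ! suc i = w ! i

length-window : ∀ p m → length (window p m) ≡ m
length-window p zero    = refl
length-window p (suc m) = cong suc (length-window (suc p) m)

window-! : ∀ p m i → i < m → window p m ! i ≡ t (p + i)
window-! p (suc m) zero    _         = cong t (sym (+-identityʳ p))
window-! p (suc m) (suc i) (s≤s i<m) = trans (window-! (suc p) m i i<m) (cong t (sym (+-suc p i)))

window-Factor : ∀ p m → Factor (window p m)
window-Factor p m = p , cong (window p) (sym (length-window p m))

Factor⇒window : ∀ {w m} → length w ≡ m → Factor w → ∃ λ p → w ≡ window p m
Factor⇒window refl fw = fw

window⇒Factor : ∀ p m {w} → w ≡ window p m → length w ≡ m × Factor w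
window⇒Factor p m refl = length-window p m , window-Factor p m

μ : List Bool → List Bool
μ []      = []
μ (c ∷ w) = c ∷ not c ∷ μ w

μ-init : List Bool → List Bool
μ-init []          = []
μ-init (c ∷ [])    = c ∷ []
μ-init (c ∷ d ∷ w) = c ∷ not c ∷ μ-init (d ∷ w)

μ-tail : List Bool → List Bool
μ-tail []      = []
μ-tail (c ∷ w) = not c ∷ μ w

μ-inner : List Bool → List Bool
μ-inner []      = []
μ-inner (c ∷ w) = not c ∷ μ-init w

window-length-cong : ∀ {w p m n} → m ≡ n → w ≡ window p n → w ≡ window p m
window-length-cong refl e = e

μ-window : ∀ p k → μ (window p k) ≡ window (2 * p) (2 * k)
μ-window p zero    = refl
μ-window p (suc k) = window-length-cong (*-suc 2 k) $
  cong₂ _∷_ (sym (t[2n]≡t[n] p)) (cong₂ _∷_ (sym (t[1+2n]≡not-t[n] p))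
    (trans (μ-window (suc p) k) (cong (λ q → window q (2 * k)) (*-suc 2 p))))

μ-init-window : ∀ p k → μ-init (window p (suc k)) ≡ window (2 * p) (suc (2 * k))
μ-init-window p zero    = cong (_∷ []) (sym (t[2n]≡t[n] p))
μ-init-window p (suc k) = window-length-cong (cong suc (*-suc 2 k)) $
  cong₂ _∷_ (sym (t[2n]≡t[n] p)) (cong₂ _∷_ (sym (t[1+2n]≡not-t[n] p))
    (trans (μ-init-window (suc p) k) (cong (λ q → window q (suc (2 * k))) (*-suc 2 p))))

μ-tail-window : ∀ p k → μ-tail (window p (suc k)) ≡ window (suc (2 * p)) (suc (2 * k))
μ-tail-window p k = cong₂ _∷_ (sym (t[1+2n]≡not-t[n] p))
  (trans (μ-window (suc p) k) (cong (λ q → window q (2 * k)) (*-suc 2 p)))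

μ-inner-window : ∀ p k → μ-inner (window p (2 + k)) ≡ window (suc (2 * p)) (2 * suc k)
μ-inner-window p k = window-length-cong (*-suc 2 k) $ cong₂ _∷_ (sym (t[1+2n]≡not-t[n] p))
  (trans (μ-init-window (suc p) k) (cong (λ q → window q (suc (2 * k))) (*-suc 2 p)))

μ-injective : ∀ {u w} → μ u ≡ μ w → u ≡ w
μ-injective {[]}    {[]}    _ = refl
μ-injective {c ∷ u} {d ∷ w} e =
  cong₂ _∷_ (proj₁ (∷-injective e)) (μ-injective (proj₂ (∷-injective (proj₂ (∷-injective e)))))

μ-init-injective : ∀ {u w} → μ-init u ≡ μ-init w → u ≡ w
μ-init-injective {[]}        {[]}        _    = refl
μ-init-injective {c ∷ []}    {d ∷ []}    refl = refl
μ-init-injective {c ∷ c′ ∷ u} {d ∷ d′ ∷ w} e = cong₂ _∷_ (proj₁ (∷-injective e))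
  (μ-init-injective {c′ ∷ u} {d′ ∷ w} (proj₂ (∷-injective (proj₂ (∷-injective e)))))
μ-init-injective {[]}        {_ ∷ []}    ()
μ-init-injective {[]}        {_ ∷ _ ∷ _} ()
μ-init-injective {_ ∷ []}    {[]}        ()
μ-init-injective {_ ∷ _ ∷ _} {[]}        ()
μ-init-injective {_ ∷ []}    {_ ∷ _ ∷ _} ()
μ-init-injective {_ ∷ _ ∷ _} {_ ∷ []}    ()

μ-tail-injective : ∀ {u w} → μ-tail u ≡ μ-tail w → u ≡ w
μ-tail-injective {[]}    {[]}    _ = refl
μ-tail-injective {c ∷ u} {d ∷ w} e =
  cong₂ _∷_ (not-injective (proj₁ (∷-injective e))) (μ-injective (proj₂ (∷-injective e)))

μ-inner-injective : ∀ {u w} → μ-inner u ≡ μ-inner w → u ≡ w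
μ-inner-injective {[]}    {[]}    _ = refl
μ-inner-injective {c ∷ u} {d ∷ w} e =
  cong₂ _∷_ (not-injective (proj₁ (∷-injective e))) (μ-init-injective (proj₂ (∷-injective e)))

Enumerates : ℕ → List (List Bool) → Set
Enumerates m L = Unique L
               × (∀ w → w ∈ L → length w ≡ m × Factor w)
               × (∀ w → length w ≡ m → Factor w → w ∈ L)

even-odd-windows-differ : ∀ x y m → 4 ≤ m → window (2 * x) m ≢ window (suc (2 * y)) m
even-odd-windows-differ x y m 4≤m e = even-odd-mismatch x y λ i i<4 →
  trans (sym (window-! (2 * x) m i (≤-trans i<4 4≤m)))
        (trans (cong (λ w → w ! i) e) (window-! (suc (2 * y)) m i (≤-trans i<4 4≤m)))

enumerates-by-parity :
  ∀ {m a b A B} (g h : List Bool → List Bool) → 4 ≤ m →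
  Injective _≡_ _≡_ g → Injective _≡_ _≡_ h →
  (∀ p → g (window p a) ≡ window (2 * p) m) → (∀ p → h (window p b) ≡ window (suc (2 * p)) m) →
  Enumerates a A → Enumerates b B → Enumerates m (map g A ++ map h B)
enumerates-by-parity {m} {a} {b} {A} {B} g h 4≤m g-inj h-inj g-win h-win
                     (A-unique , A-sound , A-complete) (B-unique , B-sound , B-complete) =
  UP.++⁺ (UP.map⁺ g-inj A-unique) (UP.map⁺ h-inj B-unique) disjoint , sound , complete
  where
  A-window : ∀ {u} → u ∈ A → ∃ λ p → u ≡ window p a
  A-window u∈A = Factor⇒window (proj₁ (A-sound _ u∈A)) (proj₂ (A-sound _ u∈A))
  B-window : ∀ {u} → u ∈ B → ∃ λ p → u ≡ window p b
  B-window u∈B = Factor⇒window (proj₁ (B-sound _ u∈B)) (proj₂ (B-sound _ u∈B))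

  disjoint : ∀ {w} → ¬ (w ∈ map g A × w ∈ map h B)
  disjoint (w∈gA , w∈hB) with ∈-map⁻ g w∈gA | ∈-map⁻ h w∈hB
  ... | u , u∈A , refl | u′ , u′∈B , e with A-window u∈A | B-window u′∈B
  ... | p , refl | p′ , refl =
    even-odd-windows-differ p p′ m 4≤m (trans (sym (g-win p)) (trans e (h-win p′)))

  sound : ∀ w → w ∈ map g A ++ map h B → length w ≡ m × Factor w
  sound w w∈ with ∈-++⁻ (map g A) w∈
  ... | inj₁ w∈gA with ∈-map⁻ g w∈gA
  ...   | u , u∈A , refl with A-window u∈A
  ...     | p , refl = window⇒Factor (2 * p) m (g-win p)
  sound w w∈ | inj₂ w∈hB with ∈-map⁻ h w∈hB
  ...   | u , u∈B , refl with B-window u∈B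
  ...     | p , refl = window⇒Factor (suc (2 * p)) m (h-win p)

  complete : ∀ w → length w ≡ m → Factor w → w ∈ map g A ++ map h B
  complete w |w|≡m fw with Factor⇒window |w|≡m fw
  ... | p , refl with even⊎odd p
  ...   | inj₁ (q , refl) = ∈-++⁺ˡ (subst (_∈ map g A) (g-win q)
          (∈-map⁺ g (A-complete (window q a) (length-window q a) (window-Factor q a))))
  ...   | inj₂ (q , refl) = ∈-++⁺ʳ (map g A) (subst (_∈ map h B) (h-win q)
          (∈-map⁺ h (B-complete (window q b) (length-window q b) (window-Factor q b))))

small-factors : ℕ → List (List Bool)
small-factors 0 = [] ∷ []
small-factors 1 = (false ∷ []) ∷ (true ∷ []) ∷ []
small-factors 2 = (false ∷ false ∷ []) ∷ (false ∷ true ∷ []) ∷ (true ∷ false ∷ []) ∷ (true ∷ true ∷ []) ∷ []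
small-factors 3 = (false ∷ false ∷ true ∷ []) ∷ (false ∷ true ∷ false ∷ []) ∷ (false ∷ true ∷ true ∷ [])
                ∷ (true ∷ false ∷ false ∷ []) ∷ (true ∷ false ∷ true ∷ []) ∷ (true ∷ true ∷ false ∷ []) ∷ []
small-factors _ = []

-- The occurrence witnesses are positions in t = 0110 1001 1001 0110 ….
small-factors-enumerates : ∀ m → m < 4 → Enumerates m (small-factors m)
small-factors-enumerates 0 _ = [] ∷ []
  , (λ { w (here refl) → refl , 0 , refl })
  , (λ { [] _ _ → here refl })
small-factors-enumerates 1 _ = ((λ ()) ∷ []) ∷ [] ∷ []
  , (λ { w (here refl) → refl , 0 , refl ; w (there (here refl)) → refl , 1 , refl })
  , (λ { (false ∷ []) _ _ → here refl ; (true ∷ []) _ _ → there (here refl) })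
small-factors-enumerates 2 _ = ((λ ()) ∷ (λ ()) ∷ (λ ()) ∷ []) ∷ ((λ ()) ∷ (λ ()) ∷ []) ∷ ((λ ()) ∷ []) ∷ [] ∷ []
  , (λ { w (here refl) → refl , 5 , refl ; w (there (here refl)) → refl , 0 , refl
       ; w (there (there (here refl))) → refl , 2 , refl ; w (there (there (there (here refl)))) → refl , 1 , refl })
  , (λ { (false ∷ false ∷ []) _ _ → here refl ; (false ∷ true ∷ []) _ _ → there (here refl)
       ; (true ∷ false ∷ []) _ _ → there (there (here refl)) ; (true ∷ true ∷ []) _ _ → there (there (there (here refl))) })
small-factors-enumerates 3 _ =
  ((λ ()) ∷ (λ ()) ∷ (λ ()) ∷ (λ ()) ∷ (λ ()) ∷ []) ∷ ((λ ()) ∷ (λ ()) ∷ (λ ()) ∷ (λ ()) ∷ [])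
    ∷ ((λ ()) ∷ (λ ()) ∷ (λ ()) ∷ []) ∷ ((λ ()) ∷ (λ ()) ∷ []) ∷ ((λ ()) ∷ []) ∷ [] ∷ []
  , (λ { w (here refl) → refl , 5 , refl ; w (there (here refl)) → refl , 3 , refl
       ; w (there (there (here refl))) → refl , 0 , refl ; w (there (there (there (here refl)))) → refl , 4 , refl
       ; w (there (there (there (there (here refl))))) → refl , 2 , refl
       ; w (there (there (there (there (there (here refl)))))) → refl , 1 , refl })
  , complete
  where
  no-cube : ∀ {c} p → c ∷ c ∷ c ∷ [] ≢ window p 3
  no-cube p e with ∷-injective e
  ... | e₀ , e′ with ∷-injective e′
  ... | e₁ , e″ = t-cube-free p (trans (sym e₀) e₁) (trans (sym e₁) (proj₁ (∷-injective e″)))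
  complete : ∀ w → length w ≡ 3 → Factor w → w ∈ small-factors 3
  complete (false ∷ false ∷ false ∷ []) _ (p , e) = ⊥-elim (no-cube p e)
  complete (false ∷ false ∷ true  ∷ []) _ _ = here refl
  complete (false ∷ true  ∷ false ∷ []) _ _ = there (here refl)
  complete (false ∷ true  ∷ true  ∷ []) _ _ = there (there (here refl))
  complete (true  ∷ false ∷ false ∷ []) _ _ = there (there (there (here refl)))
  complete (true  ∷ false ∷ true  ∷ []) _ _ = there (there (there (there (here refl))))
  complete (true  ∷ true  ∷ false ∷ []) _ _ = there (there (there (there (there (here refl)))))
  complete (true  ∷ true  ∷ true  ∷ []) _ (p , e) = ⊥-elim (no-cube p e)
small-factors-enumerates (suc (suc (suc (suc _)))) (s≤s (s≤s (s≤s (s≤s ()))))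

-- factors-fuel fu m is correct whenever m < fu; the fuel only makes the recursion structural.
factors-fuel : ℕ → ℕ → List (List Bool)
factors-step : ℕ → ℕ → ℕ → List (List Bool)
factors-fuel zero     m = []
factors-fuel (suc fu) m = if m <ᵇ 4 then small-factors m else factors-step fu (m / 2) (m % 2)
factors-step fu k zero    = map μ (factors-fuel fu k) ++ map μ-inner (factors-fuel fu (suc k))
factors-step fu k (suc _) = map μ-init (factors-fuel fu (suc k)) ++ map μ-tail (factors-fuel fu (suc k))

4≤m⇒m<ᵇ4≡false : ∀ m → 4 ≤ m → (m <ᵇ 4) ≡ false
4≤m⇒m<ᵇ4≡false m 4≤m with m <ᵇ 4 in eq
... | false = refl
... | true  = ⊥-elim (<⇒≱ (<ᵇ⇒< m 4 (subst T (sym eq) _)) 4≤m)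

factors-fuel-small : ∀ fu m → m < 4 → factors-fuel (suc fu) m ≡ small-factors m
factors-fuel-small fu 0 _ = refl
factors-fuel-small fu 1 _ = refl
factors-fuel-small fu 2 _ = refl
factors-fuel-small fu 3 _ = refl
factors-fuel-small fu (suc (suc (suc (suc _)))) (s≤s (s≤s (s≤s (s≤s ()))))

factors-fuel-even : ∀ fu k → 2 ≤ k →
  factors-fuel (suc fu) (2 * k) ≡ map μ (factors-fuel fu k) ++ map μ-inner (factors-fuel fu (suc k))
factors-fuel-even fu k 2≤k
  rewrite 4≤m⇒m<ᵇ4≡false (2 * k) (*-monoʳ-≤ 2 2≤k) | [2*n]/2≡n k | [2*n]%2≡0 k = refl

factors-fuel-odd : ∀ fu k → 2 ≤ k →
  factors-fuel (suc fu) (suc (2 * k)) ≡ map μ-init (factors-fuel fu (suc k)) ++ map μ-tail (factors-fuel fu (suc k))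
factors-fuel-odd fu k 2≤k
  rewrite 4≤m⇒m<ᵇ4≡false (suc (2 * k)) (m≤n⇒m≤1+n (*-monoʳ-≤ 2 2≤k)) | [1+2*n]/2≡n k | [1+2*n]%2≡1 k = refl

data LargeParity : ℕ → Set where
  even : ∀ k → 2 ≤ k → LargeParity (2 * k)
  odd  : ∀ k → 2 ≤ k → LargeParity (suc (2 * k))

large-parity : ∀ m → 4 ≤ m → LargeParity m
large-parity m 4≤m with even⊎odd m
... | inj₁ (k , refl) = even k (*-cancelˡ-≤ 2 4≤m)
... | inj₂ (k , refl) = odd k (2≤k k 4≤m)
  where 2≤k : ∀ k → 4 ≤ suc (2 * k) → 2 ≤ k
        2≤k 0             (s≤s ())
        2≤k 1             (s≤s (s≤s (s≤s ())))
        2≤k (suc (suc k)) _ = s≤s (s≤s z≤n)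

2+k≤2k : ∀ k → 2 ≤ k → 2 + k ≤ 2 * k
2+k≤2k k 2≤k = subst (2 + k ≤_) (sym (cong (λ n → k + n) (+-identityʳ k))) (+-monoˡ-≤ k 2≤k)

even-children-fuel : ∀ {fu} k → 2 ≤ k → 2 * k < suc fu → suc k < fu
even-children-fuel (suc k) 2≤k 2k<1+fu = ≤-trans (2+k≤2k (suc k) 2≤k) (≤-pred 2k<1+fu)

odd-child-fuel : ∀ {fu} k → 2 ≤ k → suc (2 * k) < suc fu → suc k < fu
odd-child-fuel k 2≤k 1+2k<1+fu = ≤-trans (2+k≤2k k 2≤k) (≤-trans (n≤1+n _) (≤-pred 1+2k<1+fu))

factors-fuel-enumerates : ∀ fu m → m < fu → Enumerates m (factors-fuel fu m)
factors-fuel-enumerates (suc fu) m m<1+fu with m <? 4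
... | yes m<4 = subst (Enumerates m) (sym (factors-fuel-small fu m m<4)) (small-factors-enumerates m m<4)
... | no m≮4 with large-parity m (≮⇒≥ m≮4)
...   | even (suc k) 2≤k =
  subst (Enumerates (2 * suc k)) (sym (factors-fuel-even fu (suc k) 2≤k)) $
  enumerates-by-parity μ μ-inner (*-monoʳ-≤ 2 2≤k) μ-injective μ-inner-injective
    (λ p → μ-window p (suc k)) (λ p → μ-inner-window p k)
    (factors-fuel-enumerates fu (suc k) (<-trans (n<1+n _) children<fu))
    (factors-fuel-enumerates fu (2 + k) children<fu)
  where children<fu = even-children-fuel (suc k) 2≤k m<1+fu
...   | odd k 2≤k =
  subst (Enumerates (suc (2 * k))) (sym (factors-fuel-odd fu k 2≤k)) $
  enumerates-by-parity μ-init μ-tail (≤-trans (*-monoʳ-≤ 2 2≤k) (n≤1+n _)) μ-init-injective μ-tail-injective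
    (λ p → μ-init-window p k) (λ p → μ-tail-window p k)
    child child
  where child = factors-fuel-enumerates fu (suc k) (odd-child-fuel k 2≤k m<1+fu)

factors-fuel-irrelevant : ∀ fu fu′ m → m < fu → m < fu′ → factors-fuel fu m ≡ factors-fuel fu′ m
factors-fuel-irrelevant (suc fu) (suc fu′) m m<1+fu m<1+fu′ with m <? 4
... | yes m<4 = trans (factors-fuel-small fu m m<4) (sym (factors-fuel-small fu′ m m<4))
... | no m≮4 with large-parity m (≮⇒≥ m≮4)
...   | even k 2≤k = begin
  factors-fuel (suc fu) (2 * k)
    ≡⟨ factors-fuel-even fu k 2≤k ⟩
  map μ (factors-fuel fu k) ++ map μ-inner (factors-fuel fu (suc k))
    ≡⟨ cong₂ (λ A B → map μ A ++ map μ-inner B)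
             (factors-fuel-irrelevant fu fu′ k (<-trans (n<1+n k) children<fu) (<-trans (n<1+n k) children<fu′))
             (factors-fuel-irrelevant fu fu′ (suc k) children<fu children<fu′) ⟩
  map μ (factors-fuel fu′ k) ++ map μ-inner (factors-fuel fu′ (suc k))
    ≡⟨ factors-fuel-even fu′ k 2≤k ⟨
  factors-fuel (suc fu′) (2 * k) ∎
  where open ≡-Reasoning
        children<fu  = even-children-fuel k 2≤k m<1+fu
        children<fu′ = even-children-fuel k 2≤k m<1+fu′
...   | odd k 2≤k = begin
  factors-fuel (suc fu) (suc (2 * k))
    ≡⟨ factors-fuel-odd fu k 2≤k ⟩
  map μ-init (factors-fuel fu (suc k)) ++ map μ-tail (factors-fuel fu (suc k))
    ≡⟨ cong (λ A → map μ-init A ++ map μ-tail A) (factors-fuel-irrelevant fu fu′ (suc k)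
             (odd-child-fuel k 2≤k m<1+fu) (odd-child-fuel k 2≤k m<1+fu′)) ⟩
  map μ-init (factors-fuel fu′ (suc k)) ++ map μ-tail (factors-fuel fu′ (suc k))
    ≡⟨ factors-fuel-odd fu′ k 2≤k ⟨
  factors-fuel (suc fu′) (suc (2 * k)) ∎
  where open ≡-Reasoning

factors : ℕ → List (List Bool)
factors m = factors-fuel (suc m) m

factors-enumerates : ∀ m → Enumerates m (factors m)
factors-enumerates m = factors-fuel-enumerates (suc m) m ≤-refl

factors-even : ∀ k → 2 ≤ k → factors (2 * k) ≡ map μ (factors k) ++ map μ-inner (factors (suc k))
factors-even k 2≤k = trans (factors-fuel-even (2 * k) k 2≤k)
  (cong₂ (λ A B → map μ A ++ map μ-inner B)
         (factors-fuel-irrelevant (2 * k) (suc k) k (<-trans (n<1+n k) 1+k<2k) ≤-refl)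
         (factors-fuel-irrelevant (2 * k) (2 + k) (suc k) 1+k<2k ≤-refl))
  where 1+k<2k = even-children-fuel k 2≤k ≤-refl

factors-odd : ∀ k → 2 ≤ k →
  factors (suc (2 * k)) ≡ map μ-init (factors (suc k)) ++ map μ-tail (factors (suc k))
factors-odd k 2≤k = trans (factors-fuel-odd (suc (2 * k)) k 2≤k)
  (cong (λ A → map μ-init A ++ map μ-tail A)
        (factors-fuel-irrelevant (suc (2 * k)) (2 + k) (suc k) (odd-child-fuel k 2≤k ≤-refl) ≤-refl))

-- Borders

_==_ : Bool → Bool → Bool
true  == b = b
false == b = not b

==⇒≡ : ∀ a b → a == b ≡ true → a ≡ b
==⇒≡ true  true  _ = refl
==⇒≡ false false _ = refl

≡⇒== : ∀ {a b} → a ≡ b → a == b ≡ true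
≡⇒== {true}  refl = refl
≡⇒== {false} refl = refl

∧-trueˡ : ∀ {a b} → a ∧ b ≡ true → a ≡ true
∧-trueˡ {true} {true} _ = refl

∧-trueʳ : ∀ {a b} → a ∧ b ≡ true → b ≡ true
∧-trueʳ {true} {true} _ = refl

all< : ℕ → (ℕ → Bool) → Bool
all< zero    P = true
all< (suc n) P = all< n P ∧ P n

any< : ℕ → (ℕ → Bool) → Bool
any< zero    P = false
any< (suc n) P = any< n P ∨ P n

any-in : ℕ → ℕ → (ℕ → Bool) → Bool
any-in j m P = any< (m ∸ j) (λ i → P (j + i))

all<-sound : ∀ n P → all< n P ≡ true → ∀ i → i < n → P i ≡ true
all<-sound (suc n) P e i i<1+n with m≤n⇒m<n∨m≡n (≤-pred i<1+n)
... | inj₁ i<n  = all<-sound n P (∧-trueˡ e) i i<n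
... | inj₂ refl = ∧-trueʳ {all< n P} e

all<-complete : ∀ n P → (∀ i → i < n → P i ≡ true) → all< n P ≡ true
all<-complete zero    P _   = refl
all<-complete (suc n) P all
  rewrite all<-complete n P (λ i i<n → all i (m≤n⇒m≤1+n i<n)) | all n ≤-refl = refl

any<-sound : ∀ n P → any< n P ≡ true → ∃ λ i → i < n × P i ≡ true
any<-sound (suc n) P e with any< n P in found
... | true  = let i , i<n , Pi = any<-sound n P found in i , m≤n⇒m≤1+n i<n , Pi
... | false = n , ≤-refl , e

any<-complete : ∀ n P i → i < n → P i ≡ true → any< n P ≡ true
any<-complete (suc n) P i i<1+n Pi with m≤n⇒m<n∨m≡n (≤-pred i<1+n)
... | inj₁ i<n  rewrite any<-complete n P i i<n Pi = refl
... | inj₂ refl rewrite Pi = ∨-zeroʳ (any< i P)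

i<m∸j⇒j+i<m : ∀ {i j m} → i < m ∸ j → j + i < m
i<m∸j⇒j+i<m {i} {j} {m} i<m∸j = subst (_≤ m) (trans (+-comm (suc i) j) (+-suc j i))
  (m≤o∸n⇒m+n≤o (suc i) (<⇒≤ (m∸n≢0⇒n<m λ m∸j≡0 → n≮0 (subst (i <_) m∸j≡0 i<m∸j))) i<m∸j)

any-in-sound : ∀ j m P → any-in j m P ≡ true → ∃ λ L → j ≤ L × L < m × P L ≡ true
any-in-sound j m P e with any<-sound (m ∸ j) (λ i → P (j + i)) e
... | i , i<m∸j , Pj+i = j + i , m≤m+n j i , i<m∸j⇒j+i<m i<m∸j , Pj+i

any-in-complete : ∀ j m P L → j ≤ L → L < m → P L ≡ true → any-in j m P ≡ true
any-in-complete j m P L j≤L L<m PL =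
  any<-complete (m ∸ j) (λ i → P (j + i)) (L ∸ j) (∸-monoˡ-< L<m j≤L)
    (subst (λ L → P L ≡ true) (sym (m+[n∸m]≡n j≤L)) PL)

all<-cong : ∀ n P Q → (∀ i → i < n → P i ≡ Q i) → all< n P ≡ all< n Q
all<-cong zero    P Q _  = refl
all<-cong (suc n) P Q eq = cong₂ _∧_ (all<-cong n P Q (λ i i<n → eq i (m≤n⇒m≤1+n i<n))) (eq n ≤-refl)

any<-cong : ∀ n P Q → (∀ i → i < n → P i ≡ Q i) → any< n P ≡ any< n Q
any<-cong zero    P Q _  = refl
any<-cong (suc n) P Q eq = cong₂ _∨_ (any<-cong n P Q (λ i i<n → eq i (m≤n⇒m≤1+n i<n))) (eq n ≤-refl)

any-in-cong : ∀ j m P Q → (∀ L → L < m → P L ≡ Q L) → any-in j m P ≡ any-in j m Q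
any-in-cong j m P Q eq = any<-cong (m ∸ j) _ _ λ i i<m∸j → eq (j + i) (i<m∸j⇒j+i<m i<m∸j)

any<-+ : ∀ x y P → any< (x + y) P ≡ any< x P ∨ any< y (λ i → P (x + i))
any<-+ x zero    P = trans (cong (λ n → any< n P) (+-identityʳ x)) (sym (∨-identityʳ _))
any<-+ x (suc y) P = trans (cong (λ n → any< n P) (+-suc x y))
  (trans (cong (_∨ P (x + y)) (any<-+ x y P)) (∨-assoc (any< x P) _ _))

any-in-split : ∀ j k m P → j ≤ k → k ≤ m → any-in j m P ≡ any-in j k P ∨ any-in k m P
any-in-split j k m P j≤k k≤m = begin
  any< (m ∸ j) (λ i → P (j + i))
    ≡⟨ cong (λ n → any< n (λ i → P (j + i))) m∸j≡[k∸j]+[m∸k] ⟩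
  any< ((k ∸ j) + (m ∸ k)) (λ i → P (j + i))
    ≡⟨ any<-+ (k ∸ j) (m ∸ k) (λ i → P (j + i)) ⟩
  any-in j k P ∨ any< (m ∸ k) (λ i → P (j + (k ∸ j + i)))
    ≡⟨ cong (any-in j k P ∨_) (any<-cong (m ∸ k) _ _ λ i _ →
         cong P (trans (sym (+-assoc j (k ∸ j) i)) (cong (_+ i) (m+[n∸m]≡n j≤k)))) ⟩
  any-in j k P ∨ any-in k m P ∎
  where
  open ≡-Reasoning
  m∸j≡[k∸j]+[m∸k] : m ∸ j ≡ (k ∸ j) + (m ∸ k)
  m∸j≡[k∸j]+[m∸k] = begin
    m ∸ j               ≡⟨ cong (_∸ j) (m∸n+n≡m k≤m) ⟨
    (m ∸ k) + k ∸ j     ≡⟨ +-∸-assoc (m ∸ k) j≤k ⟩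
    (m ∸ k) + (k ∸ j)   ≡⟨ +-comm (m ∸ k) (k ∸ j) ⟩
    (k ∸ j) + (m ∸ k)   ∎

!-++ˡ : ∀ (u v : List Bool) i → i < length u → (u ++ v) ! i ≡ u ! i
!-++ˡ (_ ∷ u) v zero    _         = refl
!-++ˡ (_ ∷ u) v (suc i) (s≤s i<n) = !-++ˡ u v i i<n

!-++ʳ : ∀ (u v : List Bool) i → (u ++ v) ! (length u + i) ≡ v ! i
!-++ʳ []      v i = refl
!-++ʳ (_ ∷ u) v i = !-++ʳ u v i

!-take : ∀ L (w : List Bool) i → i < L → take L w ! i ≡ w ! i
!-take (suc L) []      i       _         = refl
!-take (suc L) (_ ∷ w) zero    _         = refl
!-take (suc L) (_ ∷ w) (suc i) (s≤s i<L) = !-take L w i i<L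

!-drop : ∀ d (w : List Bool) i → drop d w ! i ≡ w ! (d + i)
!-drop zero    w       i = refl
!-drop (suc d) []      i = refl
!-drop (suc d) (_ ∷ w) i = !-drop d w i

!-extensionality : ∀ u w → length u ≡ length w → (∀ i → i < length u → u ! i ≡ w ! i) → u ≡ w
!-extensionality []      []      _ _  = refl
!-extensionality (a ∷ u) (b ∷ w) e eq =
  cong₂ _∷_ (eq 0 (s≤s z≤n)) (!-extensionality u w (suc-injective e) (λ i i<n → eq (suc i) (s≤s i<n)))

border-at : List Bool → ℕ → Bool
border-at w L = all< L (λ i → (w ! i) == (w ! (length w ∸ L + i)))

has-border-from : ℕ → List Bool → Bool
has-border-from j w = any-in j (length w) (border-at w)

non-empty⇒1≤length : ∀ (v : List Bool) → v ≢ [] → 1 ≤ length v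
non-empty⇒1≤length []      v≢[] = ⊥-elim (v≢[] refl)
non-empty⇒1≤length (_ ∷ _) _    = s≤s z≤n

Bordered⇒has-border : ∀ w → Bordered w → has-border-from 1 w ≡ true
Bordered⇒has-border w (v , v≢[] , v≢w , (u₁ , v++u₁≡w) , (u₂ , u₂++v≡w)) =
  any-in-complete 1 (length w) (border-at w) (length v) (non-empty⇒1≤length v v≢[]) |v|<|w|
    (all<-complete (length v) _ λ i i<|v| → ≡⇒== (prefix≡suffix i i<|v|))
  where
  |w|≡|v|+|u₁| : length w ≡ length v + length u₁
  |w|≡|v|+|u₁| = trans (sym (cong length v++u₁≡w)) (length-++ v)
  u₁≢[] : u₁ ≢ []
  u₁≢[] refl = v≢w (trans (sym (++-identityʳ v)) v++u₁≡w)
  |v|<|w| : length v < length w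
  |v|<|w| = subst (length v <_) (sym |w|≡|v|+|u₁|)
    (subst (_< length v + length u₁) (+-identityʳ (length v)) (+-monoʳ-< (length v) (non-empty⇒1≤length u₁ u₁≢[])))
  |w|∸|v|≡|u₂| : length w ∸ length v ≡ length u₂
  |w|∸|v|≡|u₂| = trans (cong (λ w → length w ∸ length v) (sym u₂++v≡w))
                       (trans (cong (_∸ length v) (length-++ u₂)) (m+n∸n≡m (length u₂) (length v)))
  prefix≡suffix : ∀ i → i < length v → w ! i ≡ w ! (length w ∸ length v + i)
  prefix≡suffix i i<|v| = begin
    w ! i                              ≡⟨ cong (λ w → w ! i) v++u₁≡w ⟨
    (v ++ u₁) ! i                      ≡⟨ !-++ˡ v u₁ i i<|v| ⟩
    v ! i                              ≡⟨ !-++ʳ u₂ v i ⟨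
    (u₂ ++ v) ! (length u₂ + i)        ≡⟨ cong (λ w → w ! (length u₂ + i)) u₂++v≡w ⟩
    w ! (length u₂ + i)                ≡⟨ cong (λ n → w ! (n + i)) |w|∸|v|≡|u₂| ⟨
    w ! (length w ∸ length v + i)      ∎
    where open ≡-Reasoning

has-border⇒Bordered : ∀ w → has-border-from 1 w ≡ true → Bordered w
has-border⇒Bordered w e with any-in-sound 1 (length w) (border-at w) e
... | L , 1≤L , L<|w| , border =
  v , v≢[] , v≢w , (drop L w , take++drop≡id L w) , (take d w , trans (cong (take d w ++_) v≡suffix) (take++drop≡id d w))
  where
  v = take L w
  d = length w ∸ L
  |v|≡L : length v ≡ L
  |v|≡L = trans (length-take L w) (m≤n⇒m⊓n≡m (<⇒≤ L<|w|))
  v≢[] : v ≢ []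
  v≢[] v≡[] = <⇒≱ 1≤L (≤-reflexive (trans (sym |v|≡L) (cong length v≡[])))
  v≢w : v ≢ w
  v≢w v≡w = <-irrefl (trans (sym |v|≡L) (cong length v≡w)) L<|w|
  v≡suffix : v ≡ drop d w
  v≡suffix = !-extensionality v (drop d w)
    (trans |v|≡L (trans (sym (m∸[m∸n]≡n (<⇒≤ L<|w|))) (sym (length-drop d w))))
    λ i i<|v| → let i<L = subst (i <_) |v|≡L i<|v| in
      trans (!-take L w i i<L) (trans (==⇒≡ _ _ (all<-sound L _ border i i<L)) (sym (!-drop d w i)))

window-border-at : ℕ → ℕ → ℕ → Bool
window-border-at p m L = all< L (λ i → t (p + i) == t (p + i + (m ∸ L)))

window-has-border-from : ℕ → ℕ → ℕ → Bool
window-has-border-from j p m = any-in j m (window-border-at p m)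

m∸L+i<m : ∀ m L i → i < L → L ≤ m → m ∸ L + i < m
m∸L+i<m m L i i<L L≤m = subst (m ∸ L + i <_) (m∸n+n≡m L≤m) (+-monoʳ-< (m ∸ L) i<L)

has-border-window : ∀ j p m → has-border-from j (window p m) ≡ window-has-border-from j p m
has-border-window j p m rewrite length-window p m = any-in-cong j m _ _ λ L L<m →
  all<-cong L _ _ λ i i<L → cong₂ _==_ (window-! p m i (<-trans i<L L<m))
    (trans (window-! p m (m ∸ L + i) (m∸L+i<m m L i i<L (<⇒≤ L<m)))
           (cong t (trans (sym (+-assoc p (m ∸ L) i)) (+-assoc-comm p (m ∸ L) i))))
  where +-assoc-comm : ∀ p d i → p + d + i ≡ p + i + d
        +-assoc-comm = solve-∀

window-border-at⇒Agree : ∀ p m L → window-border-at p m L ≡ true → Agree p (m ∸ L) L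
window-border-at⇒Agree p m L border = agreement λ i i<L → ==⇒≡ _ _ (all<-sound L _ border i i<L)

Agree⇒window-border-at : ∀ p m L → Agree p (m ∸ L) L → window-border-at p m L ≡ true
Agree⇒window-border-at p m L (agreement agree) = all<-complete L _ λ i i<L → ≡⇒== (agree i i<L)

agree-prefix : ∀ {p d L} L′ → L′ ≤ L → Agree p d L → Agree p d L′
agree-prefix L′ L′≤L (agreement agree) = agreement λ i i<L′ → agree i (≤-trans i<L′ L′≤L)

-- The least K with 2K − a − b ≥ 4: a preimage border of length K gives an image border of length
-- 2K − a − b, and image borders of length at most 3 are handled separately.
min-border : Bool → Bool → ℕ
min-border false false = 2
min-border _     _     = 3

5≤2K⇒3≤K : ∀ K → 5 ≤ 2 * K → 3 ≤ K
5≤2K⇒3≤K 0                   ()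
5≤2K⇒3≤K 1                   (s≤s (s≤s ()))
5≤2K⇒3≤K 2                   (s≤s (s≤s (s≤s (s≤s ()))))
5≤2K⇒3≤K (suc (suc (suc K))) _ = s≤s (s≤s (s≤s z≤n))

min-border-from-image : ∀ a b {K L} → 4 ≤ L → 2 * K ≡ L + (bit a + bit b) → min-border a b ≤ K
min-border-from-image false false 4≤L 2K≡ =
  *-cancelˡ-≤ 2 (subst (4 ≤_) (sym (trans 2K≡ (+-identityʳ _))) 4≤L)
min-border-from-image false true  4≤L 2K≡ = 5≤2K⇒3≤K _ (subst (5 ≤_) (sym 2K≡) (+-mono-≤ 4≤L (s≤s z≤n)))
min-border-from-image true  false 4≤L 2K≡ = 5≤2K⇒3≤K _ (subst (5 ≤_) (sym 2K≡) (+-mono-≤ 4≤L (s≤s z≤n)))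
min-border-from-image true  true  4≤L 2K≡ = 5≤2K⇒3≤K _ (subst (5 ≤_) (sym 2K≡) (+-mono-≤ 4≤L (s≤s z≤n)))

min-border-room : ∀ a b {K} → min-border a b ≤ K → 4 + (bit a + bit b) ≤ 2 * K
min-border-room false false m≤K = *-monoʳ-≤ 2 m≤K
min-border-room false true  m≤K = ≤-trans (n≤1+n 5) (*-monoʳ-≤ 2 m≤K)
min-border-room true  false m≤K = ≤-trans (n≤1+n 5) (*-monoʳ-≤ 2 m≤K)
min-border-room true  true  m≤K = *-monoʳ-≤ 2 m≤K

image-shift : ∀ m c k L e → m + c ≡ 2 * k → L + 2 * e ≡ m → e ≤ k × 2 * (k ∸ e) ≡ L + c
image-shift m c k L e m+c≡2k L+2e≡m = e≤k , (begin
  2 * (k ∸ e)             ≡⟨ *-distribˡ-∸ 2 k e ⟩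
  2 * k ∸ 2 * e           ≡⟨ cong (_∸ 2 * e) L+c+2e≡2k ⟨
  L + c + 2 * e ∸ 2 * e   ≡⟨ m+n∸n≡m (L + c) (2 * e) ⟩
  L + c                   ∎)
  where
  open ≡-Reasoning
  swap : ∀ L c d → L + c + d ≡ L + d + c
  swap = solve-∀
  L+c+2e≡2k : L + c + 2 * e ≡ 2 * k
  L+c+2e≡2k = trans (swap L c (2 * e)) (trans (cong (_+ c) L+2e≡m) m+c≡2k)
  e≤k : e ≤ k
  e≤k = *-cancelˡ-≤ 2 (subst (2 * e ≤_) L+c+2e≡2k (m≤n+m (2 * e) (L + c)))

preimage-shift : ∀ m c k K e → m + c ≡ 2 * k → K + e ≡ k → c ≤ 2 * K → (2 * K ∸ c) + 2 * e ≡ m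
preimage-shift m c k K e m+c≡2k K+e≡k c≤2K = +-cancelʳ-≡ c _ _ (begin
  (2 * K ∸ c) + 2 * e + c   ≡⟨ swap (2 * K ∸ c) (2 * e) c ⟩
  (2 * K ∸ c) + c + 2 * e   ≡⟨ cong (_+ 2 * e) (m∸n+n≡m c≤2K) ⟩
  2 * K + 2 * e             ≡⟨ *-distribˡ-+ 2 K e ⟨
  2 * (K + e)               ≡⟨ cong (2 *_) K+e≡k ⟩
  2 * k                     ≡⟨ m+c≡2k ⟨
  m + c                     ∎)
  where
  open ≡-Reasoning
  swap : ∀ L c d → L + c + d ≡ L + d + c
  swap = solve-∀

-- Synchronisation makes the shift of a long border of the image even, so it comes from a border
-- of the preimage.
image-border⇒preimage-border : ∀ q k m a b L → m + (bit a + bit b) ≡ 2 * k → 4 ≤ L → L < m →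
  Agree (2 * q + bit a) (m ∸ L) L → ∃ λ K → min-border a b ≤ K × K < k × Agree q (k ∸ K) K
image-border⇒preimage-border q k m a b L m+c≡2k 4≤L L<m agreeL
  with distance-even (2 * q + bit a) (m ∸ L) (agree-prefix 4 4≤L agreeL)
... | e , m∸L≡2e =
  k ∸ e , min-border-from-image a b 4≤L 2K≡L+c , ∸-monoʳ-< 0<e e≤k ,
  subst (λ d → Agree q d (k ∸ e)) (sym (m∸[m∸n]≡n e≤k))
    (agree-halve q e L (k ∸ e) a 2K≤L+a+1 (≤-trans (s≤s z≤n) 4≤L) (subst (λ d → Agree (2 * q + bit a) d L) m∸L≡2e agreeL))
  where
  L+2e≡m : L + 2 * e ≡ m
  L+2e≡m = trans (+-comm L (2 * e)) (trans (cong (_+ L) (sym m∸L≡2e)) (m∸n+n≡m (<⇒≤ L<m)))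
  e≤k = proj₁ (image-shift m (bit a + bit b) k L e m+c≡2k L+2e≡m)
  2K≡L+c = proj₂ (image-shift m (bit a + bit b) k L e m+c≡2k L+2e≡m)
  0<e : 0 < e
  0<e = n≢0⇒n>0 λ e≡0 → <⇒≱ L<m (m∸n≡0⇒m≤n (trans m∸L≡2e (cong (2 *_) e≡0)))
  2K≤L+a+1 : 2 * (k ∸ e) ≤ L + bit a + 1
  2K≤L+a+1 = ≤-trans (≤-reflexive (trans 2K≡L+c (sym (+-assoc L (bit a) (bit b)))))
                     (+-monoʳ-≤ (L + bit a) (bit≤1 b))

preimage-border⇒image-border : ∀ q k m a b K → m + (bit a + bit b) ≡ 2 * k → min-border a b ≤ K → K < k →
  Agree q (k ∸ K) K → ∃ λ L → 4 ≤ L × L < m × Agree (2 * q + bit a) (m ∸ L) L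
preimage-border⇒image-border q k m a b K m+c≡2k min≤K K<k agreeK =
  L , 4≤L , L<m ,
  subst (λ d → Agree (2 * q + bit a) d L) (sym m∸L≡2e) (agree-shrink (bit a) L (agree-double q e K agreeK) a+L≤2K)
  where
  c = bit a + bit b
  e = k ∸ K
  L = 2 * K ∸ c
  room : 4 + c ≤ 2 * K
  room = min-border-room a b min≤K
  c≤2K : c ≤ 2 * K
  c≤2K = ≤-trans (m≤n+m c 4) room
  4≤L : 4 ≤ L
  4≤L = subst (_≤ L) (m+n∸n≡m 4 c) (∸-monoˡ-≤ c room)
  L+2e≡m : L + 2 * e ≡ m
  L+2e≡m = preimage-shift m c k K e m+c≡2k (m+[n∸m]≡n (<⇒≤ K<k)) c≤2K
  m∸L≡2e : m ∸ L ≡ 2 * e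
  m∸L≡2e = trans (cong (_∸ L) (sym L+2e≡m)) (m+n∸m≡n L (2 * e))
  L<m : L < m
  L<m = subst (L <_) L+2e≡m (m<m+n L (≤-trans (s≤s z≤n) (*-monoʳ-≤ 2 (m<n⇒0<n∸m K<k))))
  a+L≤2K : bit a + L ≤ 2 * K
  a+L≤2K = ≤-trans (+-monoˡ-≤ L (m≤m+n (bit a) (bit b))) (≤-reflexive (m+[n∸m]≡n c≤2K))

⇔true⇒≡ : ∀ {x y} → (x ≡ true → y ≡ true) → (y ≡ true → x ≡ true) → x ≡ y
⇔true⇒≡ {true}  {true}  _ _ = refl
⇔true⇒≡ {false} {false} _ _ = refl
⇔true⇒≡ {true}  {false} x⇒y _ = sym (x⇒y refl)
⇔true⇒≡ {false} {true}  _ y⇒x = y⇒x refl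

long-border-transfer : ∀ q k m a b → m + (bit a + bit b) ≡ 2 * k →
  window-has-border-from 4 (2 * q + bit a) m ≡ window-has-border-from (min-border a b) q k
long-border-transfer q k m a b m+c≡2k = ⇔true⇒≡ image⇒preimage preimage⇒image
  where
  p = 2 * q + bit a
  image⇒preimage : window-has-border-from 4 p m ≡ true → window-has-border-from (min-border a b) q k ≡ true
  image⇒preimage h with any-in-sound 4 m (window-border-at p m) h
  ... | L , 4≤L , L<m , border
    with image-border⇒preimage-border q k m a b L m+c≡2k 4≤L L<m (window-border-at⇒Agree p m L border)
  ... | K , min≤K , K<k , agreeK =
    any-in-complete (min-border a b) k (window-border-at q k) K min≤K K<k (Agree⇒window-border-at q k K agreeK)
  preimage⇒image : window-has-border-from (min-border a b) q k ≡ true → window-has-border-from 4 p m ≡ true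
  preimage⇒image h with any-in-sound (min-border a b) k (window-border-at q k) h
  ... | K , min≤K , K<k , border
    with preimage-border⇒image-border q k m a b K m+c≡2k min≤K K<k (window-border-at⇒Agree q k K border)
  ... | L , 4≤L , L<m , agreeL =
    any-in-complete 4 m (window-border-at p m) L 4≤L L<m (Agree⇒window-border-at p m L agreeL)

-- Profiles

record Profile : Set where
  constructor profile
  field
    first second penultimate last : Bool
    border≥1 border≥2 border≥3    : Bool

profile-of : List Bool → Profile
profile-of w = profile (w ! 0) (w ! 1) (w ! (length w ∸ 2)) (w ! (length w ∸ 1))
                       (has-border-from 1 w) (has-border-from 2 w) (has-border-from 3 w)

window-profile : ℕ → ℕ → Profile
window-profile p m = profile (t p) (t (p + 1)) (t (p + (m ∸ 2))) (t (p + (m ∸ 1)))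
  (window-has-border-from 1 p m) (window-has-border-from 2 p m) (window-has-border-from 3 p m)

profile-cong : ∀ {a₀ a₁ a₂ a₃ a₄ a₅ a₆ b₀ b₁ b₂ b₃ b₄ b₅ b₆} →
  a₀ ≡ b₀ → a₁ ≡ b₁ → a₂ ≡ b₂ → a₃ ≡ b₃ → a₄ ≡ b₄ → a₅ ≡ b₅ → a₆ ≡ b₆ →
  profile a₀ a₁ a₂ a₃ a₄ a₅ a₆ ≡ profile b₀ b₁ b₂ b₃ b₄ b₅ b₆
profile-cong refl refl refl refl refl refl refl = refl

profile-window : ∀ p m → 2 ≤ m → profile-of (window p m) ≡ window-profile p m
profile-window p (suc zero)    (s≤s ())
profile-window p (suc (suc m)) _ =
  profile-cong (trans (window-! p (2 + m) 0 (s≤s z≤n)) (cong t (+-identityʳ p)))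
               (window-! p (2 + m) 1 (s≤s (s≤s z≤n)))
               (trans (cong (λ n → window p (2 + m) ! (n ∸ 2)) (length-window p (2 + m))) (window-! p (2 + m) m (n≤1+n _)))
               (trans (cong (λ n → window p (2 + m) ! (n ∸ 1)) (length-window p (2 + m))) (window-! p (2 + m) (suc m) ≤-refl))
               (has-border-window 1 p (2 + m)) (has-border-window 2 p (2 + m)) (has-border-window 3 p (2 + m))

letters3 : Bool → Bool → Bool → ℕ → Bool
letters3 x y z 0 = x
letters3 x y z 1 = y
letters3 x y z _ = z

-- The letters at positions a, a + 1, a + 2 of μ (x₀ ∷ x₁ ∷ _).
image-letters : Bool → Bool → Bool → ℕ → Bool
image-letters false x₀ x₁ = letters3 x₀ (not x₀) x₁
image-letters true  x₀ x₁ = letters3 (not x₀) x₁ (not x₁)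

-- Borders of length j ≤ L ≤ 3 of a word of length at least 4 whose first three letters are F
-- and whose last three letters are G.
short-border-from : ℕ → (ℕ → Bool) → (ℕ → Bool) → Bool
short-border-from j F G = any-in j 4 (λ L → all< L (λ i → F i == G (3 ∸ L + i)))

-- The profile of the image window, cut by a letters at the front and b at the back.
image-profile : Bool → Bool → Profile → Profile
image-profile a b (profile x₀ x₁ y₀ y₁ _ b₂ b₃) =
  profile (F 0) (F 1) (G 1) (G 2) (short-border-from 1 F G ∨ long)
          (short-border-from 2 F G ∨ long) (short-border-from 3 F G ∨ long)
  where F = image-letters a x₀ x₁
        G = image-letters (not b) y₀ y₁
        long = if a ∨ b then b₃ else b₂

t-image-letters : ∀ y a i → i < 3 → t (2 * y + bit a + i) ≡ image-letters a (t y) (t (y + 1)) i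
t-image-letters y false 0 _ = t-even y (ix y)
  where ix : ∀ y → 2 * y + 0 + 0 ≡ 2 * y
        ix = solve-∀
t-image-letters y false 1 _ = t-odd y (ix y)
  where ix : ∀ y → 2 * y + 0 + 1 ≡ suc (2 * y)
        ix = solve-∀
t-image-letters y false 2 _ = t-even (y + 1) (ix y)
  where ix : ∀ y → 2 * y + 0 + 2 ≡ 2 * (y + 1)
        ix = solve-∀
t-image-letters y true  0 _ = t-odd y (ix y)
  where ix : ∀ y → 2 * y + 1 + 0 ≡ suc (2 * y)
        ix = solve-∀
t-image-letters y true  1 _ = t-even (y + 1) (ix y)
  where ix : ∀ y → 2 * y + 1 + 1 ≡ 2 * (y + 1)
        ix = solve-∀
t-image-letters y true  2 _ = t-odd (y + 1) (ix y)
  where ix : ∀ y → 2 * y + 1 + 2 ≡ suc (2 * (y + 1))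
        ix = solve-∀
t-image-letters y a (suc (suc (suc i))) (s≤s (s≤s (s≤s ())))

short-borders-window : ∀ j p m F G → (∀ i → i < 3 → t (p + i) ≡ F i) →
  (∀ r → r < 3 → t (p + m + r) ≡ G r) → any-in j 4 (window-border-at p (3 + m)) ≡ short-border-from j F G
short-borders-window j p m F G first last = any-in-cong j 4 _ _ λ L L<4 → all<-cong L _ _ λ i i<L →
  cong₂ _==_ (first i (≤-trans i<L (≤-pred L<4)))
             (trans (cong t (suffix-index L i L<4 i<L)) (last (3 ∸ L + i) (m∸L+i<m 3 L i i<L (≤-pred L<4))))
  where
  suffix-index : ∀ L i → L < 4 → i < L → p + i + (3 + m ∸ L) ≡ p + m + (3 ∸ L + i)
  suffix-index 1 0 _ _ = ix p m
    where ix : ∀ p m → p + 0 + (2 + m) ≡ p + m + 2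
          ix = solve-∀
  suffix-index 1 (suc _) _ (s≤s ())
  suffix-index 2 i _ _ = ix p m i
    where ix : ∀ p m i → p + i + (1 + m) ≡ p + m + (1 + i)
          ix = solve-∀
  suffix-index 3 i _ _ = ix p m i
    where ix : ∀ p m i → p + i + m ≡ p + m + i
          ix = solve-∀
  suffix-index (suc (suc (suc (suc _)))) _ (s≤s (s≤s (s≤s (s≤s ())))) _

long-border-profile : ∀ q k a b →
  window-has-border-from (min-border a b) q k ≡ (if a ∨ b then window-has-border-from 3 q k else window-has-border-from 2 q k)
long-border-profile q k false false = refl
long-border-profile q k false true  = refl
long-border-profile q k true  false = refl
long-border-profile q k true  true  = refl

suffix-start : ∀ y P b → P + 3 + bit b ≡ 2 * (2 + y) → P ≡ 2 * y + bit (not b)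
suffix-start y P false e = +-cancelʳ-≡ 3 _ _ (trans (sym (+-identityʳ _)) (trans e (ix y)))
  where ix : ∀ y → 2 * (2 + y) ≡ 2 * y + 1 + 3
        ix = solve-∀
suffix-start y P true  e = +-cancelʳ-≡ 4 _ _ (trans (ix′ P) (trans e (ix y)))
  where ix : ∀ y → 2 * (2 + y) ≡ 2 * y + 0 + 4
        ix = solve-∀
        ix′ : ∀ P → P + 4 ≡ P + 3 + 1
        ix′ = solve-∀

window-profile-image : ∀ q k m a b → m + (bit a + bit b) ≡ 2 * k → 4 ≤ m → 2 ≤ k →
  window-profile (2 * q + bit a) m ≡ image-profile a b (window-profile q k)
window-profile-image q (suc (suc k)) (suc (suc (suc m))) a b m+c≡2k (s≤s (s≤s (s≤s 1≤m))) _ =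
  profile-cong (trans (cong t (sym (+-identityʳ p))) (first 0 (s≤s z≤n)))
               (first 1 (s≤s (s≤s z≤n)))
               (trans (cong t (ix₁ p m)) (last 1 (s≤s (s≤s z≤n))))
               (trans (cong t (ix₂ p m)) (last 2 ≤-refl))
               (borders 1 (s≤s z≤n)) (borders 2 (s≤s (s≤s z≤n))) (borders 3 (s≤s (s≤s (s≤s z≤n))))
  where
  p = 2 * q + bit a
  F = image-letters a (t q) (t (q + 1))
  G = image-letters (not b) (t (q + k)) (t (q + suc k))
  first : ∀ i → i < 3 → t (p + i) ≡ F i
  first = t-image-letters q a
  P≡ : p + m ≡ 2 * (q + k) + bit (not b)
  P≡ = suffix-start (q + k) (p + m) b (trans (ix q (bit a) m (bit b))
         (trans (cong (λ n → 2 * q + n) m+c≡2k) (trans (sym (*-distribˡ-+ 2 q (2 + k))) (cong (2 *_) (+-comm-2 q k)))))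
    where ix : ∀ q a m b → 2 * q + a + m + 3 + b ≡ 2 * q + (3 + m + (a + b))
          ix = solve-∀
          +-comm-2 : ∀ q k → q + (2 + k) ≡ 2 + (q + k)
          +-comm-2 = solve-∀
  last : ∀ r → r < 3 → t (p + m + r) ≡ G r
  last r r<3 = trans (cong (λ P → t (P + r)) P≡) (trans (t-image-letters (q + k) (not b) r r<3)
    (cong (λ y → image-letters (not b) (t (q + k)) (t y) r) (ix q k)))
    where ix : ∀ q k → q + k + 1 ≡ q + suc k
          ix = solve-∀
  ix₁ : ∀ p m → p + suc m ≡ p + m + 1
  ix₁ = solve-∀
  ix₂ : ∀ p m → p + suc (suc m) ≡ p + m + 2
  ix₂ = solve-∀
  borders : ∀ j → j ≤ 3 → window-has-border-from j p (3 + m)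
    ≡ short-border-from j F G ∨ (if a ∨ b then window-has-border-from 3 q (2 + k) else window-has-border-from 2 q (2 + k))
  borders j j≤3 = begin
    window-has-border-from j p (3 + m)
      ≡⟨ any-in-split j 4 (3 + m) (window-border-at p (3 + m)) (m≤n⇒m≤1+n j≤3) (s≤s (s≤s (s≤s 1≤m))) ⟩
    any-in j 4 (window-border-at p (3 + m)) ∨ window-has-border-from 4 p (3 + m)
      ≡⟨ cong₂ _∨_ (short-borders-window j p m F G first last) (long-border-transfer q (2 + k) (3 + m) a b m+c≡2k) ⟩
    short-border-from j F G ∨ window-has-border-from (min-border a b) q (2 + k)
      ≡⟨ cong (short-border-from j F G ∨_) (long-border-profile q (2 + k) a b) ⟩
    _ ∎
    where open ≡-Reasoning

-- Weighted counts of factors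

Weight : Set
Weight = Profile → ℤ

sumℤ : List ℤ → ℤ
sumℤ = foldr ℤ._+_ (+ 0)

weighted-count : ℕ → Weight → ℤ
weighted-count m h = sumℤ (map (h ∘ profile-of) (factors m))

module _ {A : Set} where

  sumℤ-++ : ∀ (g : A → ℤ) xs ys → sumℤ (map g (xs ++ ys)) ≡ sumℤ (map g xs) ℤ.+ sumℤ (map g ys)
  sumℤ-++ g []       ys = sym (ℤP.+-identityˡ _)
  sumℤ-++ g (x ∷ xs) ys = trans (cong (λ s → g x ℤ.+ s) (sumℤ-++ g xs ys)) (sym (ℤP.+-assoc (g x) _ _))

  sumℤ-cong : ∀ (g h : A → ℤ) xs → (∀ x → x ∈ xs → g x ≡ h x) → sumℤ (map g xs) ≡ sumℤ (map h xs)
  sumℤ-cong g h []       _  = refl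
  sumℤ-cong g h (x ∷ xs) eq = cong₂ ℤ._+_ (eq x (here refl)) (sumℤ-cong g h xs (λ y y∈xs → eq y (there y∈xs)))

  sumℤ-+ : ∀ (g h : A → ℤ) xs → sumℤ (map (λ x → g x ℤ.+ h x) xs) ≡ sumℤ (map g xs) ℤ.+ sumℤ (map h xs)
  sumℤ-+ g h []       = refl
  sumℤ-+ g h (x ∷ xs) = trans (cong (λ s → g x ℤ.+ h x ℤ.+ s) (sumℤ-+ g h xs)) (interchange (g x) (h x) _ _)
    where interchange : ∀ a b c d → a ℤ.+ b ℤ.+ (c ℤ.+ d) ≡ a ℤ.+ c ℤ.+ (b ℤ.+ d)
          interchange = solve-∀-ℤ

  sumℤ-* : ∀ c (g : A → ℤ) xs → sumℤ (map (λ x → c ℤ.* g x) xs) ≡ c ℤ.* sumℤ (map g xs)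
  sumℤ-* c g []       = sym (ℤP.*-zeroʳ c)
  sumℤ-* c g (x ∷ xs) = trans (cong (λ s → c ℤ.* g x ℤ.+ s) (sumℤ-* c g xs)) (sym (ℤP.*-distribˡ-+ c (g x) _))

  sumℤ-0 : ∀ (xs : List A) → sumℤ (map (λ _ → + 0) xs) ≡ + 0
  sumℤ-0 []       = refl
  sumℤ-0 (_ ∷ xs) = trans (ℤP.+-identityˡ _) (sumℤ-0 xs)

weighted-count-cong : ∀ m g h → (∀ σ → g σ ≡ h σ) → weighted-count m g ≡ weighted-count m h
weighted-count-cong m g h eq = sumℤ-cong _ _ (factors m) (λ w _ → eq (profile-of w))

weighted-count-+ : ∀ m g h → weighted-count m (λ σ → g σ ℤ.+ h σ) ≡ weighted-count m g ℤ.+ weighted-count m h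
weighted-count-+ m g h = sumℤ-+ _ _ (factors m)

weighted-count-* : ∀ m c h → weighted-count m (λ σ → c ℤ.* h σ) ≡ c ℤ.* weighted-count m h
weighted-count-* m c h = sumℤ-* c _ (factors m)

weighted-count-0 : ∀ m → weighted-count m (λ _ → + 0) ≡ + 0
weighted-count-0 m = sumℤ-0 (factors m)

window-of-factor : ∀ k {u} → u ∈ factors k → ∃ λ p → u ≡ window p k
window-of-factor k u∈ = Factor⇒window (proj₁ (proj₁ (proj₂ (factors-enumerates k)) _ u∈))
                                      (proj₂ (proj₁ (proj₂ (factors-enumerates k)) _ u∈))

profile-image : ∀ q k m a b → m + (bit a + bit b) ≡ 2 * k → 4 ≤ m → 2 ≤ k →
  profile-of (window (2 * q + bit a) m) ≡ image-profile a b (profile-of (window q k))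
profile-image q k m a b m+c≡2k 4≤m 2≤k = begin
  profile-of (window (2 * q + bit a) m)           ≡⟨ profile-window _ m (≤-trans (s≤s (s≤s z≤n)) 4≤m) ⟩
  window-profile (2 * q + bit a) m                ≡⟨ window-profile-image q k m a b m+c≡2k 4≤m 2≤k ⟩
  image-profile a b (window-profile q k)          ≡⟨ cong (image-profile a b) (profile-window q k 2≤k) ⟨
  image-profile a b (profile-of (window q k))     ∎
  where open ≡-Reasoning

decoded-profile : ∀ {k m} (g : List Bool → List Bool) a b → m + (bit a + bit b) ≡ 2 * k → 4 ≤ m → 2 ≤ k →
  (∀ p → g (window p k) ≡ window (2 * p + bit a) m) →
  ∀ u → u ∈ factors k → profile-of (g u) ≡ image-profile a b (profile-of u)
decoded-profile {k} {m} g a b m+c≡2k 4≤m 2≤k g-window u u∈ with window-of-factor k u∈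
... | p , refl = trans (cong profile-of (g-window p)) (profile-image p k m a b m+c≡2k 4≤m 2≤k)

weighted-count-decoded : ∀ {k m} (g : List Bool → List Bool) a b → m + (bit a + bit b) ≡ 2 * k → 4 ≤ m → 2 ≤ k →
  (∀ p → g (window p k) ≡ window (2 * p + bit a) m) →
  ∀ h → sumℤ (map (h ∘ profile-of) (map g (factors k))) ≡ weighted-count k (h ∘ image-profile a b)
weighted-count-decoded {k} g a b m+c≡2k 4≤m 2≤k g-window h =
  trans (cong sumℤ (sym (map-∘ (factors k))))
        (sumℤ-cong _ _ (factors k) λ u u∈ → cong h (decoded-profile g a b m+c≡2k 4≤m 2≤k g-window u u∈))

weighted-count-even : ∀ k → 2 ≤ k → ∀ h → weighted-count (2 * k) h
  ≡ weighted-count k (h ∘ image-profile false false) ℤ.+ weighted-count (suc k) (h ∘ image-profile true true)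
weighted-count-even k 2≤k h = begin
  weighted-count (2 * k) h
    ≡⟨ cong (λ L → sumℤ (map (h ∘ profile-of) L)) (factors-even k 2≤k) ⟩
  sumℤ (map (h ∘ profile-of) (map μ (factors k) ++ map μ-inner (factors (suc k))))
    ≡⟨ sumℤ-++ (h ∘ profile-of) (map μ (factors k)) _ ⟩
  sumℤ (map (h ∘ profile-of) (map μ (factors k))) ℤ.+ sumℤ (map (h ∘ profile-of) (map μ-inner (factors (suc k))))
    ≡⟨ cong₂ ℤ._+_ (weighted-count-decoded μ false false (ix₀ k) 4≤2k 2≤k μ-window′ h)
                   (weighted-count-decoded μ-inner true true (ix₁ k) 4≤2k (m≤n⇒m≤1+n 2≤k) μ-inner-window′ h) ⟩
  weighted-count k (h ∘ image-profile false false) ℤ.+ weighted-count (suc k) (h ∘ image-profile true true) ∎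
  where
  open ≡-Reasoning
  4≤2k = *-monoʳ-≤ 2 2≤k
  ix₀ : ∀ k → 2 * k + (0 + 0) ≡ 2 * k
  ix₀ = solve-∀
  ix₁ : ∀ k → 2 * k + (1 + 1) ≡ 2 * suc k
  ix₁ = solve-∀
  μ-window′ : ∀ p → μ (window p k) ≡ window (2 * p + 0) (2 * k)
  μ-window′ p = trans (μ-window p k) (cong (λ q → window q (2 * k)) (sym (+-identityʳ (2 * p))))
  μ-inner-window′ : ∀ p → μ-inner (window p (suc k)) ≡ window (2 * p + 1) (2 * k)
  μ-inner-window′ p = inner k 2≤k
    where inner : ∀ k → 2 ≤ k → μ-inner (window p (suc k)) ≡ window (2 * p + 1) (2 * k)
          inner (suc k) _ = trans (μ-inner-window p k) (cong (λ q → window q (2 * suc k)) (+-comm 1 (2 * p)))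

weighted-count-odd : ∀ k → 2 ≤ k → ∀ h → weighted-count (suc (2 * k)) h
  ≡ weighted-count (suc k) (λ σ → h (image-profile false true σ) ℤ.+ h (image-profile true false σ))
weighted-count-odd k 2≤k h = begin
  weighted-count (suc (2 * k)) h
    ≡⟨ cong (λ L → sumℤ (map (h ∘ profile-of) L)) (factors-odd k 2≤k) ⟩
  sumℤ (map (h ∘ profile-of) (map μ-init (factors (suc k)) ++ map μ-tail (factors (suc k))))
    ≡⟨ sumℤ-++ (h ∘ profile-of) (map μ-init (factors (suc k))) _ ⟩
  sumℤ (map (h ∘ profile-of) (map μ-init (factors (suc k)))) ℤ.+ sumℤ (map (h ∘ profile-of) (map μ-tail (factors (suc k))))
    ≡⟨ cong₂ ℤ._+_ (weighted-count-decoded μ-init false true (ix₀ k) 4≤1+2k 2≤1+k μ-init-window′ h)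
                   (weighted-count-decoded μ-tail true false (ix₁ k) 4≤1+2k 2≤1+k μ-tail-window′ h) ⟩
  weighted-count (suc k) (h ∘ image-profile false true) ℤ.+ weighted-count (suc k) (h ∘ image-profile true false)
    ≡⟨ weighted-count-+ (suc k) (h ∘ image-profile false true) (h ∘ image-profile true false) ⟨
  weighted-count (suc k) (λ σ → h (image-profile false true σ) ℤ.+ h (image-profile true false σ)) ∎
  where
  open ≡-Reasoning
  4≤1+2k = m≤n⇒m≤1+n (*-monoʳ-≤ 2 2≤k)
  2≤1+k = m≤n⇒m≤1+n 2≤k
  ix₀ : ∀ k → suc (2 * k) + (0 + 1) ≡ 2 * suc k
  ix₀ = solve-∀
  ix₁ : ∀ k → suc (2 * k) + (1 + 0) ≡ 2 * suc k
  ix₁ = solve-∀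
  μ-init-window′ : ∀ p → μ-init (window p (suc k)) ≡ window (2 * p + 0) (suc (2 * k))
  μ-init-window′ p = trans (μ-init-window p k) (cong (λ q → window q (suc (2 * k))) (sym (+-identityʳ (2 * p))))
  μ-tail-window′ : ∀ p → μ-tail (window p (suc k)) ≡ window (2 * p + 1) (suc (2 * k))
  μ-tail-window′ p = trans (μ-tail-window p k) (cong (λ q → window q (suc (2 * k))) (+-comm 1 (2 * p)))

-- A form c₀ ∷ c₁ ∷ … stands for n ↦ Σ_j weighted-count (n + j) c_j.
Form : Set
Form = List Weight

eval : ℕ → Form → ℤ
eval n []      = + 0
eval n (c ∷ F) = weighted-count n c ℤ.+ eval (suc n) F

zeroʷ : Weight
zeroʷ _ = + 0

infixl 6 _+ʷ_
infixl 4 _⊕_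

_+ʷ_ : Weight → Weight → Weight
(g +ʷ h) σ = g σ ℤ.+ h σ

_⊕_ : Form → Form → Form
[]      ⊕ G       = G
(g ∷ F) ⊕ []      = g ∷ F
(g ∷ F) ⊕ (h ∷ G) = (g +ʷ h) ∷ (F ⊕ G)

_⊙_ : ℤ → Form → Form
c ⊙ F = map (λ h σ → c ℤ.* h σ) F

eval-⊕ : ∀ n F G → eval n (F ⊕ G) ≡ eval n F ℤ.+ eval n G
eval-⊕ n []      G       = sym (ℤP.+-identityˡ _)
eval-⊕ n (g ∷ F) []      = sym (ℤP.+-identityʳ _)
eval-⊕ n (g ∷ F) (h ∷ G) =
  trans (cong₂ ℤ._+_ (weighted-count-+ n g h) (eval-⊕ (suc n) F G))
        (interchange (weighted-count n g) (weighted-count n h) (eval (suc n) F) (eval (suc n) G))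
  where interchange : ∀ a b c d → a ℤ.+ b ℤ.+ (c ℤ.+ d) ≡ a ℤ.+ c ℤ.+ (b ℤ.+ d)
        interchange = solve-∀-ℤ

eval-⊙ : ∀ n c F → eval n (c ⊙ F) ≡ c ℤ.* eval n F
eval-⊙ n c []      = sym (ℤP.*-zeroʳ c)
eval-⊙ n c (h ∷ F) =
  trans (cong₂ ℤ._+_ (weighted-count-* n c h) (eval-⊙ (suc n) c F)) (sym (ℤP.*-distribˡ-+ c _ _))

eval-shift : ∀ n F → eval (suc n) F ≡ eval n (zeroʷ ∷ F)
eval-shift n F = sym (trans (cong (ℤ._+ eval (suc n) F) (weighted-count-0 n)) (ℤP.+-identityˡ _))

odd-weight : Weight → Weight
odd-weight h = (h ∘ image-profile false true) +ʷ (h ∘ image-profile true false)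

expand : Form → Form
expand []            = []
expand (c ∷ [])      = c ∘ image-profile false false ∷ c ∘ image-profile true true ∷ []
expand (c₀ ∷ c₁ ∷ F) =
  c₀ ∘ image-profile false false ∷ (((c₀ ∘ image-profile true true +ʷ odd-weight c₁) ∷ []) ⊕ expand F)

eval-expand : ∀ n → 2 ≤ n → ∀ F → eval (2 * n) F ≡ eval n (expand F)
eval-expand n 2≤n []       = refl
eval-expand n 2≤n (c ∷ []) =
  trans (cong (ℤ._+ + 0) (weighted-count-even n 2≤n c))
        (ℤP.+-assoc (weighted-count n (c ∘ image-profile false false)) (weighted-count (suc n) (c ∘ image-profile true true)) (+ 0))
eval-expand n 2≤n (c₀ ∷ c₁ ∷ F) = begin
  weighted-count (2 * n) c₀ ℤ.+ (weighted-count (suc (2 * n)) c₁ ℤ.+ eval (2 + 2 * n) F)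
    ≡⟨ cong₂ ℤ._+_ (weighted-count-even n 2≤n c₀) (cong₂ ℤ._+_ (weighted-count-odd n 2≤n c₁)
         (trans (cong (λ m → eval m F) (sym (*-suc 2 n))) (eval-expand (suc n) (m≤n⇒m≤1+n 2≤n) F))) ⟩
  a ℤ.+ b ℤ.+ (c ℤ.+ d)
    ≡⟨ regroup a b c d ⟩
  a ℤ.+ (b ℤ.+ c ℤ.+ + 0 ℤ.+ d)
    ≡⟨ cong (λ x → a ℤ.+ (x ℤ.+ + 0 ℤ.+ d)) (weighted-count-+ (suc n) (c₀ ∘ image-profile true true) (odd-weight c₁)) ⟨
  a ℤ.+ (eval (suc n) ((c₀ ∘ image-profile true true +ʷ odd-weight c₁) ∷ []) ℤ.+ d)
    ≡⟨ cong (λ x → a ℤ.+ x) (eval-⊕ (suc n) (_ ∷ []) (expand F)) ⟨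
  eval n (expand (c₀ ∷ c₁ ∷ F)) ∎
  where
  open ≡-Reasoning
  a = weighted-count n (c₀ ∘ image-profile false false)
  b = weighted-count (suc n) (c₀ ∘ image-profile true true)
  c = weighted-count (suc n) (odd-weight c₁)
  d = eval (suc n) (expand F)
  regroup : ∀ a b c d → a ℤ.+ b ℤ.+ (c ℤ.+ d) ≡ a ℤ.+ (b ℤ.+ c ℤ.+ + 0 ℤ.+ d)
  regroup = solve-∀-ℤ

∀ᵇ : (Bool → Bool) → Bool
∀ᵇ P = P false ∧ P true

∀ᵇ-sound : ∀ P → ∀ᵇ P ≡ true → ∀ x → P x ≡ true
∀ᵇ-sound P all false = ∧-trueˡ all
∀ᵇ-sound P all true  = ∧-trueʳ {P false} all

∀ᵛ : ∀ n → (Vec Bool n → Bool) → Bool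
∀ᵛ zero    P = P []
∀ᵛ (suc n) P = ∀ᵇ λ x → ∀ᵛ n (λ v → P (x ∷ v))

∀ᵛ-sound : ∀ n P → ∀ᵛ n P ≡ true → ∀ v → P v ≡ true
∀ᵛ-sound zero    P all []      = all
∀ᵛ-sound (suc n) P all (x ∷ v) = ∀ᵛ-sound n (λ v → P (x ∷ v)) (∀ᵇ-sound (λ x → ∀ᵛ n (λ v → P (x ∷ v))) all x) v

profile-fields : Profile → Vec Bool 7
profile-fields (profile x₀ x₁ y₀ y₁ b₁ b₂ b₃) = x₀ ∷ x₁ ∷ y₀ ∷ y₁ ∷ b₁ ∷ b₂ ∷ b₃ ∷ []

profile-from-fields : Vec Bool 7 → Profile
profile-from-fields (x₀ ∷ x₁ ∷ y₀ ∷ y₁ ∷ b₁ ∷ b₂ ∷ b₃ ∷ []) = profile x₀ x₁ y₀ y₁ b₁ b₂ b₃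

every-profile : (Profile → Bool) → Bool
every-profile P = ∀ᵛ 7 (P ∘ profile-from-fields)

every-profile-sound : ∀ P → every-profile P ≡ true → ∀ σ → P σ ≡ true
every-profile-sound P all σ@(profile _ _ _ _ _ _ _) = ∀ᵛ-sound 7 (P ∘ profile-from-fields) all (profile-fields σ)

is-zero : Weight → Bool
is-zero h = every-profile (λ σ → ⌊ h σ ℤ.≟ + 0 ⌋)

is-zero-sound : ∀ h → is-zero h ≡ true → ∀ σ → h σ ≡ + 0
is-zero-sound h h≡0 σ with h σ ℤ.≟ + 0 | every-profile-sound (λ σ → ⌊ h σ ℤ.≟ + 0 ⌋) h≡0 σ
... | yes hσ≡0 | _  = hσ≡0
... | no _      | ()

all-zero : Form → Bool
all-zero []      = true
all-zero (h ∷ F) = is-zero h ∧ all-zero F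

vanishes : ℕ → Form → Bool
vanishes zero    F = all-zero F
vanishes (suc d) F = vanishes d (expand F) ∧ vanishes d (expand (zeroʷ ∷ F))

eval-all-zero : ∀ n F → all-zero F ≡ true → eval n F ≡ + 0
eval-all-zero n []      _    = refl
eval-all-zero n (h ∷ F) F≡0 = cong₂ ℤ._+_
  (trans (weighted-count-cong n h zeroʷ (is-zero-sound h (∧-trueˡ F≡0))) (weighted-count-0 n))
  (eval-all-zero (suc n) F (∧-trueʳ {is-zero h} F≡0))

2a≤1+2k⇒a≤k : ∀ a k → 2 * a ≤ suc (2 * k) → a ≤ k
2a≤1+2k⇒a≤k a k 2a≤1+2k = ≮⇒≥ λ k<a →
  1+n≰n (≤-trans (≤-trans (≤-reflexive (sym (*-suc 2 k))) (*-monoʳ-≤ 2 k<a)) 2a≤1+2k)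

eval-vanishes : ∀ d F n → 2 ^ suc d ≤ n → vanishes d F ≡ true → eval n F ≡ + 0
eval-vanishes zero    F n _     v = eval-all-zero n F v
eval-vanishes (suc d) F n bound v with even⊎odd n
... | inj₁ (k , refl) =
  trans (eval-expand k (2≤k bound′) F) (eval-vanishes d (expand F) k bound′ (∧-trueˡ v))
  where bound′ = *-cancelˡ-≤ 2 bound
        2≤k = ≤-trans (*-monoʳ-≤ 2 (m^n>0 2 d))
... | inj₂ (k , refl) = trans (eval-shift (2 * k) F)
  (trans (eval-expand k (2≤k bound′) (zeroʷ ∷ F)) (eval-vanishes d (expand (zeroʷ ∷ F)) k bound′ (∧-trueʳ {vanishes d (expand F)} v)))
  where bound′ = 2a≤1+2k⇒a≤k (2 ^ suc d) k bound
        2≤k = ≤-trans (*-monoʳ-≤ 2 (m^n>0 2 d))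

-- The recurrences

unbordered? : (w : List Bool) → Dec (has-border-from 1 w ≡ false)
unbordered? w = has-border-from 1 w Bool.≟ false

unbordered-count : ℕ → ℕ
unbordered-count m = length (filter unbordered? (factors m))

unbordered-count-IsCount : ∀ n → IsCount n (unbordered-count n)
unbordered-count-IsCount n =
  filter unbordered? (factors n) , UP.filter⁺ unbordered? unique , (λ w → mk⇔ (sound w) (complete w)) , refl
  where
  unique = proj₁ (factors-enumerates n)
  sound : ∀ w → w ∈ filter unbordered? (factors n) → UnbFactor n w
  sound w w∈ with ∈-filter⁻ unbordered? w∈
  ... | w∈factors , no-border = proj₁ (proj₁ (proj₂ (factors-enumerates n)) w w∈factors)
                              , proj₂ (proj₁ (proj₂ (factors-enumerates n)) w w∈factors)
                              , λ bordered → true≢false (trans (sym (Bordered⇒has-border w bordered)) no-border)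
    where true≢false : true ≢ false
          true≢false ()
  complete : ∀ w → UnbFactor n w → w ∈ filter unbordered? (factors n)
  complete w (|w|≡n , factor , unbordered) =
    ∈-filter⁺ unbordered? (proj₂ (proj₂ (factors-enumerates n)) w |w|≡n factor) no-border
    where no-border : has-border-from 1 w ≡ false
          no-border with has-border-from 1 w in border
          ... | false = refl
          ... | true  = ⊥-elim (unbordered (has-border⇒Bordered w border))

unbordered : Weight
unbordered σ = if Profile.border≥1 σ then + 0 else + 1

count-unbordered : ∀ (L : List (List Bool)) → + length (filter unbordered? L) ≡ sumℤ (map (unbordered ∘ profile-of) L)
count-unbordered []      = refl
count-unbordered (w ∷ L) with has-border-from 1 w
... | true  = trans (count-unbordered L) (sym (ℤP.+-identityˡ _))
... | false = trans (ℤP.pos-+ 1 (length (filter unbordered? L))) (cong (λ x → + 1 ℤ.+ x) (count-unbordered L))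

unbordered-count≡weighted-count : ∀ m → + unbordered-count m ≡ weighted-count m unbordered
unbordered-count≡weighted-count m = count-unbordered (factors m)

place : ℕ → Weight → Form
place zero    c = c ∷ []
place (suc j) c = zeroʷ ∷ place j c

coefficients : Fin 8 → Fin 4 → ℤ
coefficients s j = lookup (lookup table s) j
  where
  table : Vec (Vec ℤ 4) 8
  table = (+ 2 ∷ + 0 ∷ + 0 ∷ + 0 ∷ [])
        ∷ (+ 0 ∷ + 1 ∷ + 0 ∷ + 0 ∷ [])
        ∷ (+ 0 ∷ + 1 ∷ + 0 ∷ + 1 ∷ [])
        ∷ (+ 0 ∷ ℤ.-1ℤ ∷ + 1 ∷ + 0 ∷ [])
        ∷ (+ 0 ∷ + 0 ∷ + 2 ∷ + 0 ∷ [])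
        ∷ (+ 0 ∷ + 0 ∷ + 0 ∷ + 1 ∷ [])
        ∷ (+ 0 ∷ ℤ.-1ℤ ∷ + 1 ∷ + 1 ∷ [])
        ∷ (+ 0 ∷ + 2 ∷ + 0 ∷ + 1 ∷ [])
        ∷ []

expand² expand³ : Form → Form
expand² F = expand (expand F)
expand³ F = expand (expand² F)

recurrence-term : Fin 8 → Fin 4 → Form
recurrence-term s j = (ℤ.- coefficients s j) ⊙ expand² (place (toℕ j) unbordered)

recurrence-form : Fin 8 → Form
recurrence-form s = expand³ (place (toℕ s) unbordered) ⊕ recurrence-term s (# 0) ⊕ recurrence-term s (# 1)
                    ⊕ recurrence-term s (# 2) ⊕ recurrence-term s (# 3)

recurrence-forms-vanish : ∀ s → vanishes 2 (recurrence-form s) ≡ true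
recurrence-forms-vanish = toWitness {a? = all? λ s → vanishes 2 (recurrence-form s) Bool.≟ true} _

eval-place : ∀ n j c → eval n (place j c) ≡ weighted-count (n + j) c
eval-place n zero    c = trans (ℤP.+-identityʳ _) (cong (λ m → weighted-count m c) (sym (+-identityʳ n)))
eval-place n (suc j) c = trans (sym (eval-shift n (place j c)))
  (trans (eval-place (suc n) j c) (cong (λ m → weighted-count m c) (sym (+-suc n j))))

eval-expand² : ∀ n → 2 ≤ n → ∀ F → eval (4 * n) F ≡ eval n (expand² F)
eval-expand² n 2≤n F =
  trans (cong (λ m → eval m F) (4n≡2[2n] n))
        (trans (eval-expand (2 * n) (≤-trans 2≤n (m≤m+n n (n + 0))) F) (eval-expand n 2≤n (expand F)))
  where 4n≡2[2n] : ∀ n → 4 * n ≡ 2 * (2 * n)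
        4n≡2[2n] = solve-∀

eval-expand³ : ∀ n → 2 ≤ n → ∀ F → eval (8 * n) F ≡ eval n (expand³ F)
eval-expand³ n 2≤n F =
  trans (cong (λ m → eval m F) (8n≡2[4n] n))
        (trans (eval-expand (4 * n) (≤-trans 2≤n (m≤m+n n (3 * n))) F) (eval-expand² n 2≤n (expand F)))
  where 8n≡2[4n] : ∀ n → 8 * n ≡ 2 * (4 * n)
        8n≡2[4n] = solve-∀

count-as-eval : ∀ m j → + unbordered-count (m + j) ≡ eval m (place j unbordered)
count-as-eval m j = trans (unbordered-count≡weighted-count (m + j)) (sym (eval-place m j unbordered))

recurrence-rhs : Fin 8 → ℕ → ℤ
recurrence-rhs s n = c (# 0) ℤ.* + f (4 * n + 0) ℤ.+ c (# 1) ℤ.* + f (4 * n + 1)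
                     ℤ.+ c (# 2) ℤ.* + f (4 * n + 2) ℤ.+ c (# 3) ℤ.* + f (4 * n + 3)
  where c = coefficients s
        f = unbordered-count

eval-recurrence-form : ∀ s n → 2 ≤ n →
  eval n (recurrence-form s) ≡ + unbordered-count (8 * n + toℕ s) ℤ.+ ℤ.- recurrence-rhs s n
eval-recurrence-form s n 2≤n = begin
  eval n (lead ⊕ term (# 0) ⊕ term (# 1) ⊕ term (# 2) ⊕ term (# 3))
    ≡⟨ eval-⊕ n (lead ⊕ term (# 0) ⊕ term (# 1) ⊕ term (# 2)) (term (# 3)) ⟩
  eval n (lead ⊕ term (# 0) ⊕ term (# 1) ⊕ term (# 2)) ℤ.+ eval n (term (# 3))
    ≡⟨ cong (ℤ._+ eval n (term (# 3))) (eval-⊕ n (lead ⊕ term (# 0) ⊕ term (# 1)) (term (# 2))) ⟩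
  eval n (lead ⊕ term (# 0) ⊕ term (# 1)) ℤ.+ eval n (term (# 2)) ℤ.+ eval n (term (# 3))
    ≡⟨ cong (λ y → y ℤ.+ eval n (term (# 2)) ℤ.+ eval n (term (# 3))) (eval-⊕ n (lead ⊕ term (# 0)) (term (# 1))) ⟩
  eval n (lead ⊕ term (# 0)) ℤ.+ eval n (term (# 1)) ℤ.+ eval n (term (# 2)) ℤ.+ eval n (term (# 3))
    ≡⟨ cong (λ y → y ℤ.+ eval n (term (# 1)) ℤ.+ eval n (term (# 2)) ℤ.+ eval n (term (# 3))) (eval-⊕ n lead (term (# 0))) ⟩
  eval n lead ℤ.+ eval n (term (# 0)) ℤ.+ eval n (term (# 1)) ℤ.+ eval n (term (# 2)) ℤ.+ eval n (term (# 3))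
    ≡⟨ cong₂ ℤ._+_ (cong₂ ℤ._+_ (cong₂ ℤ._+_ (cong₂ ℤ._+_ (sym (f[8n+j] (toℕ s)))
         (term-eval (# 0))) (term-eval (# 1))) (term-eval (# 2))) (term-eval (# 3)) ⟩
  x ℤ.+ ℤ.- c (# 0) ℤ.* a 0 ℤ.+ ℤ.- c (# 1) ℤ.* a 1 ℤ.+ ℤ.- c (# 2) ℤ.* a 2 ℤ.+ ℤ.- c (# 3) ℤ.* a 3
    ≡⟨ regroup x (c (# 0)) (c (# 1)) (c (# 2)) (c (# 3)) (a 0) (a 1) (a 2) (a 3) ⟩
  x ℤ.+ ℤ.- recurrence-rhs s n ∎
  where
  open ≡-Reasoning
  c = coefficients s
  lead = expand³ (place (toℕ s) unbordered)
  term : Fin 4 → Form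
  term = recurrence-term s
  x = + unbordered-count (8 * n + toℕ s)
  a : ℕ → ℤ
  a j = + unbordered-count (4 * n + j)
  f[8n+j] : ∀ j → + unbordered-count (8 * n + j) ≡ eval n (expand³ (place j unbordered))
  f[8n+j] j = trans (count-as-eval (8 * n) j) (eval-expand³ n 2≤n (place j unbordered))
  term-eval : ∀ j → eval n (term j) ≡ ℤ.- c j ℤ.* a (toℕ j)
  term-eval j = trans (eval-⊙ n (ℤ.- c j) (expand² (place (toℕ j) unbordered)))
    (cong (λ y → ℤ.- c j ℤ.* y) (trans (sym (eval-expand² n 2≤n (place (toℕ j) unbordered)))
                                       (sym (count-as-eval (4 * n) (toℕ j)))))
  regroup : ∀ x c₀ c₁ c₂ c₃ a₀ a₁ a₂ a₃ →
    x ℤ.+ ℤ.- c₀ ℤ.* a₀ ℤ.+ ℤ.- c₁ ℤ.* a₁ ℤ.+ ℤ.- c₂ ℤ.* a₂ ℤ.+ ℤ.- c₃ ℤ.* a₃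
    ≡ x ℤ.+ ℤ.- (c₀ ℤ.* a₀ ℤ.+ c₁ ℤ.* a₁ ℤ.+ c₂ ℤ.* a₂ ℤ.+ c₃ ℤ.* a₃)
  regroup = solve-∀-ℤ

recurrence-from-8 : ∀ s n → 8 ≤ n → + unbordered-count (8 * n + toℕ s) ≡ recurrence-rhs s n
recurrence-from-8 s n 8≤n = ℤP.i-j≡0⇒i≡j _ _ (trans (sym (eval-recurrence-form s n (≤-trans (s≤s (s≤s z≤n)) 8≤n)))
  (eval-vanishes 2 (recurrence-form s) n 8≤n (recurrence-forms-vanish s)))

recurrence-at? : ∀ n → Dec (∀ s → + unbordered-count (8 * n + toℕ s) ≡ recurrence-rhs s n)
recurrence-at? n = all? λ s → + unbordered-count (8 * n + toℕ s) ℤ.≟ recurrence-rhs s n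

recurrence-below-8 : ∀ n → 3 ≤ n → n < 8 → ∀ s → + unbordered-count (8 * n + toℕ s) ≡ recurrence-rhs s n
recurrence-below-8 3 _ _ = toWitness {a? = recurrence-at? 3} _
recurrence-below-8 4 _ _ = toWitness {a? = recurrence-at? 4} _
recurrence-below-8 5 _ _ = toWitness {a? = recurrence-at? 5} _
recurrence-below-8 6 _ _ = toWitness {a? = recurrence-at? 6} _
recurrence-below-8 7 _ _ = toWitness {a? = recurrence-at? 7} _
recurrence-below-8 (suc (suc (suc (suc (suc (suc (suc (suc _)))))))) _ (s≤s (s≤s (s≤s (s≤s (s≤s (s≤s (s≤s (s≤s ()))))))))
recurrence-below-8 0 () _
recurrence-below-8 1 (s≤s ()) _
recurrence-below-8 2 (s≤s (s≤s ())) _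

recurrence : ∀ n → 3 ≤ n → ∀ s → + unbordered-count (8 * n + toℕ s) ≡ recurrence-rhs s n
recurrence n 3≤n s with n <? 8
... | yes n<8 = recurrence-below-8 n 3≤n n<8 s
... | no  n≮8 = recurrence-from-8 s n (≮⇒≥ n≮8)

recurrence-instance : ∀ s n → 3 ≤ n → ∀ {m r} → 8 * n + toℕ s ≡ m → recurrence-rhs s n ≡ r → + unbordered-count m ≡ r
recurrence-instance s n 3≤n refl rhs≡r = trans (recurrence n 3≤n s) rhs≡r

private
  f = unbordered-count
  f₄ : ℕ → ℕ → ℤ
  f₄ n j = + f (4 * n + j)
  3≤3+n : ∀ {n} → 3 ≤ 3 + n
  3≤3+n = s≤s (s≤s (s≤s z≤n))

count-8n : ∀ n → 1 ≤ n → f (8 * n) ≡ 2 * f (4 * n)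
count-8n 1 _ = refl
count-8n 2 _ = refl
count-8n n@(suc (suc (suc _))) _ = ℤP.+-injective $ recurrence-instance (# 0) n 3≤3+n (+-identityʳ _) $
  trans (normalise (f₄ n 0) (f₄ n 1) (f₄ n 2) (f₄ n 3))
        (trans (cong (λ m → + 2 ℤ.* + f m) (+-identityʳ (4 * n))) (sym (ℤP.pos-* 2 (f (4 * n)))))
  where normalise : ∀ a b c d → + 2 ℤ.* a ℤ.+ + 0 ℤ.* b ℤ.+ + 0 ℤ.* c ℤ.+ + 0 ℤ.* d ≡ + 2 ℤ.* a
        normalise = solve-∀-ℤ

count-8n+1 : ∀ n → f (8 * n + 1) ≡ f (4 * n + 1)
count-8n+1 0 = refl
count-8n+1 1 = refl
count-8n+1 2 = refl
count-8n+1 n@(suc (suc (suc _))) = ℤP.+-injective $ recurrence-instance (# 1) n 3≤3+n refl $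
  normalise (f₄ n 0) (f₄ n 1) (f₄ n 2) (f₄ n 3)
  where normalise : ∀ a b c d → + 0 ℤ.* a ℤ.+ + 1 ℤ.* b ℤ.+ + 0 ℤ.* c ℤ.+ + 0 ℤ.* d ≡ b
        normalise = solve-∀-ℤ

count-8n+2 : ∀ n → 1 ≤ n → f (8 * n + 2) ≡ f (4 * n + 1) + f (4 * n + 3)
count-8n+2 1 _ = refl
count-8n+2 2 _ = refl
count-8n+2 n@(suc (suc (suc _))) _ = ℤP.+-injective $ recurrence-instance (# 2) n 3≤3+n refl $
  trans (normalise (f₄ n 0) (f₄ n 1) (f₄ n 2) (f₄ n 3)) (sym (ℤP.pos-+ (f (4 * n + 1)) (f (4 * n + 3))))
  where normalise : ∀ a b c d → + 0 ℤ.* a ℤ.+ + 1 ℤ.* b ℤ.+ + 0 ℤ.* c ℤ.+ + 1 ℤ.* d ≡ b ℤ.+ d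
        normalise = solve-∀-ℤ

count-8n+3 : ∀ n → 2 ≤ n → + f (8 * n + 3) ≡ ℤ.- (+ f (4 * n + 1)) ℤ.+ + f (4 * n + 2)
count-8n+3 1 (s≤s ())
count-8n+3 2 _ = refl
count-8n+3 n@(suc (suc (suc _))) _ = recurrence-instance (# 3) n 3≤3+n refl $
  normalise (f₄ n 0) (f₄ n 1) (f₄ n 2) (f₄ n 3)
  where normalise : ∀ a b c d → + 0 ℤ.* a ℤ.+ ℤ.-1ℤ ℤ.* b ℤ.+ + 1 ℤ.* c ℤ.+ + 0 ℤ.* d ≡ ℤ.- b ℤ.+ c
        normalise = solve-∀-ℤ

count-8n+4 : ∀ n → 1 ≤ n → f (8 * n + 4) ≡ 2 * f (4 * n + 2)
count-8n+4 1 _ = refl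
count-8n+4 2 _ = refl
count-8n+4 n@(suc (suc (suc _))) _ = ℤP.+-injective $ recurrence-instance (# 4) n 3≤3+n refl $
  trans (normalise (f₄ n 0) (f₄ n 1) (f₄ n 2) (f₄ n 3)) (sym (ℤP.pos-* 2 (f (4 * n + 2))))
  where normalise : ∀ a b c d → + 0 ℤ.* a ℤ.+ + 0 ℤ.* b ℤ.+ + 2 ℤ.* c ℤ.+ + 0 ℤ.* d ≡ + 2 ℤ.* c
        normalise = solve-∀-ℤ

count-8n+5 : ∀ n → f (8 * n + 5) ≡ f (4 * n + 3)
count-8n+5 0 = refl
count-8n+5 1 = refl
count-8n+5 2 = refl
count-8n+5 n@(suc (suc (suc _))) = ℤP.+-injective $ recurrence-instance (# 5) n 3≤3+n refl $
  normalise (f₄ n 0) (f₄ n 1) (f₄ n 2) (f₄ n 3)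
  where normalise : ∀ a b c d → + 0 ℤ.* a ℤ.+ + 0 ℤ.* b ℤ.+ + 0 ℤ.* c ℤ.+ + 1 ℤ.* d ≡ d
        normalise = solve-∀-ℤ

count-8n+6 : ∀ n → 2 ≤ n → + f (8 * n + 6) ≡ ℤ.- (+ f (4 * n + 1)) ℤ.+ + f (4 * n + 2) ℤ.+ + f (4 * n + 3)
count-8n+6 1 (s≤s ())
count-8n+6 2 _ = refl
count-8n+6 n@(suc (suc (suc _))) _ = recurrence-instance (# 6) n 3≤3+n refl $
  normalise (f₄ n 0) (f₄ n 1) (f₄ n 2) (f₄ n 3)
  where normalise : ∀ a b c d → + 0 ℤ.* a ℤ.+ ℤ.-1ℤ ℤ.* b ℤ.+ + 1 ℤ.* c ℤ.+ + 1 ℤ.* d ≡ ℤ.- b ℤ.+ c ℤ.+ d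
        normalise = solve-∀-ℤ

count-8n+7 : ∀ n → 3 ≤ n → f (8 * n + 7) ≡ 2 * f (4 * n + 1) + f (4 * n + 3)
count-8n+7 n 3≤n = ℤP.+-injective $ recurrence-instance (# 7) n 3≤n refl $
  trans (normalise (f₄ n 0) (f₄ n 1) (f₄ n 2) (f₄ n 3))
        (trans (cong (ℤ._+ + f (4 * n + 3)) (sym (ℤP.pos-* 2 (f (4 * n + 1)))))
               (sym (ℤP.pos-+ (2 * f (4 * n + 1)) (f (4 * n + 3)))))
  where normalise : ∀ a b c d → + 0 ℤ.* a ℤ.+ + 2 ℤ.* b ℤ.+ + 0 ℤ.* c ℤ.+ + 1 ℤ.* d ≡ + 2 ℤ.* b ℤ.+ d
        normalise = solve-∀-ℤ

corollary7p6 : Σ (ℕ → ℕ) λ f →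
    (∀ n → IsCount n (f n))
    × (∀ n → 1 ≤ n → f (8 * n) ≡ 2 * f (4 * n))
    × (∀ n → f (8 * n + 1) ≡ f (4 * n + 1))
    × (∀ n → 1 ≤ n → f (8 * n + 2) ≡ f (4 * n + 1) + f (4 * n + 3))
    × (∀ n → 2 ≤ n → + f (8 * n + 3) ≡ ℤ.- (+ f (4 * n + 1)) ℤ.+ + f (4 * n + 2))
    × (∀ n → 1 ≤ n → f (8 * n + 4) ≡ 2 * f (4 * n + 2))
    × (∀ n → f (8 * n + 5) ≡ f (4 * n + 3))
    × (∀ n → 2 ≤ n → + f (8 * n + 6) ≡ ℤ.- (+ f (4 * n + 1)) ℤ.+ + f (4 * n + 2) ℤ.+ + f (4 * n + 3))
    × (∀ n → 3 ≤ n → f (8 * n + 7) ≡ 2 * f (4 * n + 1) + f (4 * n + 3))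
    × (∃ λ (c : Fin 8 → Fin 4 → ℤ) → ∀ n → 3 ≤ n → ∀ (s : Fin 8) →
         + f (8 * n + toℕ s)
           ≡ c s (Fin.zero) ℤ.* + f (4 * n + 0)
             ℤ.+ c s (Fin.suc Fin.zero) ℤ.* + f (4 * n + 1)
             ℤ.+ c s (Fin.suc (Fin.suc Fin.zero)) ℤ.* + f (4 * n + 2)
             ℤ.+ c s (Fin.suc (Fin.suc (Fin.suc Fin.zero))) ℤ.* + f (4 * n + 3))
corollary7p6 =
  unbordered-count , unbordered-count-IsCount ,
  count-8n , count-8n+1 , count-8n+2 , count-8n+3 , count-8n+4 , count-8n+5 , count-8n+6 , count-8n+7 ,
  coefficients , recurrence
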